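{- Let $(m,n)$ be a coprime pair of positive integers. Then for every $(m,n)$-Dyck path $D$, $\operatorname{dinv}(\bar D)=\operatorname{dinv}(D)$.
   Context: A path is a word in the letters $N$ (unit step $(0,1)$) and $E$ (unit step $(1,0)$) starting at $(0,0)$. An $(m,n)$-Dyck path is a path from $(0,0)$ to $(m,n)$ never going below the line $y=\frac nm x$. The rank of a lattice point $(a,b)$ is $r(a,b)=mb-na$. For a path $Q$, $Q^{rev}$ is the path whose word is that of $Q$ read backwards. Rank complement: write $D=Q_1Q_2$, where $Q_1$ consists of the steps of $D$ up to the (unique) lattice point of $D$ of maximal rank; then $\bar D=Q_1^{rev}Q_2^{rev}$, again an $(m,n)$-Dyck path. The dinv statistic: the unit squares of the $m\times n$ rectangle lying above/left of $D$ form a Young diagram anchored at the top-left corner; for such a cell $c$, $\operatorname{arm}(c)$ is the number of these cells to the right of $c$ in its row and $\operatorname{leg}(c)$ the number below $c$ in its column; $\operatorname{dinv}(D)$ is the number of such cells with $\frac{\operatorname{arm}(c)}{\operatorname{leg}(c)+1}\le\frac mn<\frac{\operatorname{arm}(c)+1}{\operatorname{leg}(c)}$ (with $\frac{\cdot}{0}=+\infty$). -}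

module Defs where

open import Data.Nat using (ℕ; zero; suc; _+_; _*_; _∸_; _≤_; _<_; _≤?_; _<?_)
open import Data.Integer as ℤ using (ℤ; +_)
open import Data.Integer using () renaming (_-_ to _-ℤ_)
open import Data.List using (List; []; _∷_; _++_; reverse; take; drop; length; filter; map; concatMap; upTo; scanl; allFin)
open import Data.Product using (_×_; _,_; proj₁; proj₂)
open import Data.Nat.GCD using ()
open import Data.Nat.Coprimality using (Coprime)
open import Data.List.Relation.Unary.All using (All)
open import Relation.Nullary using (Dec; yes; no; ¬_)
open import Relation.Nullary.Decidable using (_×-dec_)
open import Relation.Binary.PropositionalEquality using (_≡_)

-- Steps: N = (0,1), E = (1,0).
data Step : Set where
  N E : Step

Path : Set
Path = List Step

move : ℕ × ℕ → Step → ℕ × ℕ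
move (a , b) N = (a , suc b)
move (a , b) E = (suc a , b)

points : Path → List (ℕ × ℕ)
points = scanl move (0 , 0)

endpoint : Path → ℕ × ℕ
endpoint []      = (0 , 0)
endpoint (s ∷ p) = let (a , b) = endpoint p in move (a , b) s

rank : ℕ → ℕ → ℕ × ℕ → ℤ
rank m n (a , b) = (+ (m * b)) -ℤ (+ (n * a))

-- (m,n)-Dyck path: ends at (m,n) and every lattice point lies weakly above y = (n/m) x,
-- i.e. n a ≤ m b.
IsDyck : ℕ → ℕ → Path → Set
IsDyck m n D = (endpoint D ≡ (m , n)) × All (λ { (a , b) → n * a ≤ m * b }) (points D)

-- index (number of steps) of the first lattice point of maximal rank
-- argmaxFrom i best bestVal xs : scan the remaining values xs, the next having index i
argmaxFrom : ℕ → ℕ → ℤ → List ℤ → ℕ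
argmaxFrom i best bv []       = best
argmaxFrom i best bv (x ∷ xs) with x ℤ.≤? bv
... | yes _ = argmaxFrom (suc i) best bv xs
... | no  _ = argmaxFrom (suc i) i x xs

argmax : List ℤ → ℕ
argmax []       = 0
argmax (x ∷ xs) = argmaxFrom 1 0 x xs

maxRankIndex : ℕ → ℕ → Path → ℕ
maxRankIndex m n D = argmax (map (rank m n) (points D))

-- rank complement: D = Q₁ Q₂ with Q₁ the first k steps (k = index of the max-rank point),
-- D̄ = Q₁^rev Q₂^rev
rankComplement : ℕ → ℕ → Path → Path
rankComplement m n D =
  let k = maxRankIndex m n D in
  reverse (take k D) ++ reverse (drop k D)

-- heights: for each E step (column i, 0-based), the number of N steps before it,
-- i.e. the E step of column i runs from (i , h i) to (i+1 , h i).
heightsFrom : ℕ → Path → List ℕ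
heightsFrom h []      = []
heightsFrom h (N ∷ p) = heightsFrom (suc h) p
heightsFrom h (E ∷ p) = h ∷ heightsFrom h p

heights : Path → List ℕ
heights = heightsFrom 0

-- h i for column i (defaults to 0 out of range; unused there)
nth : List ℕ → ℕ → ℕ
nth []       _       = 0
nth (x ∷ xs) zero    = x
nth (x ∷ xs) (suc i) = nth xs i

-- the cells of the Young diagram above/left of D: unit squares [i,i+1]×[j,j+1]
-- (0 ≤ i < m, 0 ≤ j < n) with j ≥ h i
cells : ℕ → ℕ → Path → List (ℕ × ℕ)
cells m n D =
  filter (λ { (i , j) → nth (heights D) i ≤? j })
         (concatMap (λ i → map (λ j → (i , j)) (upTo n)) (upTo m))

-- arm: number of diagram cells to the right of (i , j) in row j
arm : ℕ → Path → ℕ × ℕ → ℕ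
arm m D (i , j) = length (filter (λ i' → (i <? i') ×-dec (nth (heights D) i' ≤? j)) (upTo m))

-- leg: number of diagram cells below (i , j) in column i
leg : Path → ℕ × ℕ → ℕ
leg D (i , j) = j ∸ nth (heights D) i

-- arm/(leg+1) ≤ m/n < (arm+1)/leg  (x/0 = +∞), cleared of the positive denominators
dinvCond : ℕ → ℕ → ℕ → ℕ → Set
dinvCond m n a l = (n * a ≤ m * (l + 1)) × (m * l < n * (a + 1))

dinvCond? : ∀ m n a l → Dec (dinvCond m n a l)
dinvCond? m n a l = (n * a ≤? m * (l + 1)) ×-dec (m * l <? n * (a + 1))

dinv : ℕ → ℕ → Path → ℕ
dinv m n D = length (filter (λ c → dinvCond? m n (arm m D c) (leg D c)) (cells m n D))

module Submission where

-- Label each step of a path by the rank of its starting point: N adds m, E subtracts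
-- n.
-- Cutting a Dyck path at its point of maximal rank gives a rising and a falling
-- piece; both are balanced, so reversing them keeps the dinv pairs, hence dinv.

open import Defs
open import Data.Nat as ℕ using (ℕ; zero; suc; _+_; _*_; _∸_; _≤_; _<_; _≤?_; _<?_; z≤n; s≤s)
import Data.Nat.Properties as ℕP
open import Data.Nat.Properties using (+-comm; +-assoc; +-identityʳ; +-commutativeSemigroup)
open import Algebra.Properties.CommutativeSemigroup +-commutativeSemigroup using (interchange)
import Data.Nat.Tactic.RingSolver as ℕ-Ring
open import Data.Nat.Coprimality using (Coprime; coprime-divisor)
open import Data.Nat.Divisibility using (_∣_; ∣⇒≤; divides)
open import Data.Integer as ℤ using (ℤ; +_; -_; 0ℤ) renaming (_+_ to _+ℤ_; _-_ to _-ℤ_)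
import Data.Integer.Properties as ℤP
open import Data.Integer.Tactic.RingSolver using (solve-∀)
open import Data.Bool using (Bool; true; false; _∧_; not)
open import Data.Bool.Properties using (∧-comm; ∧-identityʳ; ∧-zeroʳ)
open import Data.List using (List; []; _∷_; _++_; reverse; map; take; drop; length; scanl; applyUpTo; upTo; filter; concatMap; concat)
open import Data.List.Properties using (unfold-reverse; take++drop≡id)
open import Data.List.Relation.Unary.All as All using (All; []; _∷_)
import Data.List.Relation.Unary.All.Properties as AllP
open import Data.List.Relation.Unary.AllPairs using (AllPairs; []; _∷_)
open import Data.Product using (_×_; _,_; proj₁; proj₂)
open import Data.Empty using (⊥; ⊥-elim)
open import Function.Bundles using (mk⇔)
open import Relation.Nullary using (Dec; does; yes; no; ¬_)
open import Relation.Nullary.Decidable using (_×-dec_; dec-true; dec-false; does-⇔)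
open import Relation.Binary.Definitions using (tri<; tri≈; tri>)
open import Relation.Binary.PropositionalEquality

bit : Bool → ℕ
bit true  = 1
bit false = 0

module _ {A : Set} where
  open ≡-Reasoning

  count : (A → Bool) → List A → ℕ
  count p []       = 0
  count p (x ∷ xs) = bit (p x) + count p xs

  pairs : (A → A → Bool) → List A → ℕ
  pairs R []       = 0
  pairs R (x ∷ xs) = count (R x) xs + pairs R xs

  cross : (A → A → Bool) → List A → List A → ℕ
  cross R []       ys = 0
  cross R (x ∷ xs) ys = count (R x) ys + cross R xs ys

  count-cong : ∀ {P : A → Set} {f g : A → Bool} → (∀ x → P x → f x ≡ g x) →
               ∀ {xs} → All P xs → count f xs ≡ count g xs
  count-cong f≡g []         = refl
  count-cong f≡g (px ∷ pxs) = cong₂ _+_ (cong bit (f≡g _ px)) (count-cong f≡g pxs)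

  count-ext : ∀ {f g : A → Bool} → (∀ x → f x ≡ g x) → ∀ xs → count f xs ≡ count g xs
  count-ext f≡g []       = refl
  count-ext f≡g (x ∷ xs) = cong₂ _+_ (cong bit (f≡g x)) (count-ext f≡g xs)

  count-false : ∀ {f : A → Bool} → (∀ x → f x ≡ false) → ∀ xs → count f xs ≡ 0
  count-false f≡false []       = refl
  count-false f≡false (x ∷ xs) rewrite f≡false x = count-false f≡false xs

  count-++ : ∀ f xs ys → count f (xs ++ ys) ≡ count f xs + count f ys
  count-++ f []       ys = refl
  count-++ f (x ∷ xs) ys =
    trans (cong (_+_ (bit (f x))) (count-++ f xs ys)) (sym (+-assoc (bit (f x)) _ _))

  count-reverse : ∀ f xs → count f (reverse xs) ≡ count f xs
  count-reverse f []       = refl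
  count-reverse f (x ∷ xs) = begin
    count f (reverse (x ∷ xs))           ≡⟨ cong (count f) (unfold-reverse x xs) ⟩
    count f (reverse xs ++ x ∷ [])       ≡⟨ count-++ f (reverse xs) (x ∷ []) ⟩
    count f (reverse xs) + (bit (f x) + 0) ≡⟨ cong₂ _+_ (count-reverse f xs) (+-identityʳ _) ⟩
    count f xs + bit (f x)               ≡⟨ +-comm (count f xs) (bit (f x)) ⟩
    bit (f x) + count f xs               ∎

  count-reverse-pieces : ∀ f xs ys → count f (reverse xs ++ reverse ys) ≡ count f (xs ++ ys)
  count-reverse-pieces f xs ys = begin
    count f (reverse xs ++ reverse ys)            ≡⟨ count-++ f (reverse xs) (reverse ys) ⟩
    count f (reverse xs) + count f (reverse ys)   ≡⟨ cong₂ _+_ (count-reverse f xs) (count-reverse f ys) ⟩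
    count f xs + count f ys                       ≡⟨ count-++ f xs ys ⟨
    count f (xs ++ ys)                            ∎

  cross-++ˡ : ∀ R (xs zs ys : List A) → cross R (xs ++ zs) ys ≡ cross R xs ys + cross R zs ys
  cross-++ˡ R []       zs ys = refl
  cross-++ˡ R (x ∷ xs) zs ys =
    trans (cong (_+_ (count (R x) ys)) (cross-++ˡ R xs zs ys)) (sym (+-assoc (count (R x) ys) _ _))

  cross-singleton : ∀ R (xs : List A) y → cross R xs (y ∷ []) ≡ count (λ x → R x y) xs
  cross-singleton R []       y = refl
  cross-singleton R (x ∷ xs) y = cong₂ _+_ (+-identityʳ (bit (R x y))) (cross-singleton R xs y)

  pairs-++ : ∀ R (xs ys : List A) → pairs R (xs ++ ys) ≡ (pairs R xs + pairs R ys) + cross R xs ys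
  pairs-++ R []       ys = sym (+-identityʳ (pairs R ys))
  pairs-++ R (x ∷ xs) ys = begin
    count (R x) (xs ++ ys) + pairs R (xs ++ ys)
      ≡⟨ cong₂ _+_ (count-++ (R x) xs ys) (pairs-++ R xs ys) ⟩
    (count (R x) xs + count (R x) ys) + ((pairs R xs + pairs R ys) + cross R xs ys)
      ≡⟨ regroup (count (R x) xs) (count (R x) ys) (pairs R xs) (pairs R ys) (cross R xs ys) ⟩
    ((count (R x) xs + pairs R xs) + pairs R ys) + (count (R x) ys + cross R xs ys) ∎
    where
    regroup : ∀ a b c d e → (a + b) + ((c + d) + e) ≡ ((a + c) + d) + (b + e)
    regroup = ℕ-Ring.solve-∀

  pairs-reverse : ∀ R (xs : List A) → pairs R (reverse xs) ≡ pairs (λ x y → R y x) xs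
  pairs-reverse R []       = refl
  pairs-reverse R (x ∷ xs) = begin
    pairs R (reverse (x ∷ xs))          ≡⟨ cong (pairs R) (unfold-reverse x xs) ⟩
    pairs R (reverse xs ++ x ∷ [])      ≡⟨ pairs-++ R (reverse xs) (x ∷ []) ⟩
    (pairs R (reverse xs) + 0) + cross R (reverse xs) (x ∷ [])
      ≡⟨ cong₂ _+_ (trans (+-identityʳ _) (pairs-reverse R xs)) (cross-singleton R (reverse xs) x) ⟩
    pairs Rᵒ xs + count (λ z → R z x) (reverse xs)
      ≡⟨ cong (_+_ (pairs Rᵒ xs)) (count-reverse _ xs) ⟩
    pairs Rᵒ xs + count (λ z → R z x) xs ≡⟨ +-comm (pairs Rᵒ xs) _ ⟩
    count (λ z → R z x) xs + pairs Rᵒ xs ∎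
    where
    Rᵒ : A → A → Bool
    Rᵒ x y = R y x

  cross-reverseʳ : ∀ R (xs ys : List A) → cross R xs (reverse ys) ≡ cross R xs ys
  cross-reverseʳ R []       ys = refl
  cross-reverseʳ R (x ∷ xs) ys = cong₂ _+_ (count-reverse (R x) ys) (cross-reverseʳ R xs ys)

  cross-reverseˡ : ∀ R (xs ys : List A) → cross R (reverse xs) ys ≡ cross R xs ys
  cross-reverseˡ R []       ys = refl
  cross-reverseˡ R (x ∷ xs) ys = begin
    cross R (reverse (x ∷ xs)) ys        ≡⟨ cong (λ z → cross R z ys) (unfold-reverse x xs) ⟩
    cross R (reverse xs ++ x ∷ []) ys    ≡⟨ cross-++ˡ R (reverse xs) (x ∷ []) ys ⟩
    cross R (reverse xs) ys + (count (R x) ys + 0)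
      ≡⟨ cong₂ _+_ (cross-reverseˡ R xs ys) (+-identityʳ _) ⟩
    cross R xs ys + count (R x) ys       ≡⟨ +-comm (cross R xs ys) _ ⟩
    count (R x) ys + cross R xs ys       ∎

  pairs-ext : ∀ {R S : A → A → Bool} → (∀ x y → R x y ≡ S x y) → ∀ xs → pairs R xs ≡ pairs S xs
  pairs-ext R≡S []       = refl
  pairs-ext R≡S (x ∷ xs) = cong₂ _+_ (count-ext (R≡S x) xs) (pairs-ext R≡S xs)

  cross-ext : ∀ {R S : A → A → Bool} → (∀ x y → R x y ≡ S x y) → ∀ xs ys → cross R xs ys ≡ cross S xs ys
  cross-ext R≡S []       ys = refl
  cross-ext R≡S (x ∷ xs) ys = cong₂ _+_ (count-ext (R≡S x) ys) (cross-ext R≡S xs ys)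

module _ {A B : Set} where

  count-map : ∀ (f : B → Bool) (g : A → B) xs → count f (map g xs) ≡ count (λ x → f (g x)) xs
  count-map f g []       = refl
  count-map f g (x ∷ xs) = cong (_+_ (bit (f (g x)))) (count-map f g xs)

  pairs-map : ∀ (R : B → B → Bool) (g : A → B) xs →
              pairs R (map g xs) ≡ pairs (λ x y → R (g x) (g y)) xs
  pairs-map R g []       = refl
  pairs-map R g (x ∷ xs) = cong₂ _+_ (count-map (R (g x)) g xs) (pairs-map R g xs)

  cross-map : ∀ (R : B → B → Bool) (g : A → B) xs ys →
              cross R (map g xs) (map g ys) ≡ cross (λ x y → R (g x) (g y)) xs ys
  cross-map R g []       ys = refl
  cross-map R g (x ∷ xs) ys = cong₂ _+_ (count-map (R (g x)) g ys) (cross-map R g xs ys)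

module _ {A : Set} where

  countSum : List (A → Bool) → List A → ℕ
  countSum []       xs = 0
  countSum (f ∷ fs) xs = count f xs + countSum fs xs

  bitSum : List (A → Bool) → A → ℕ
  bitSum []       x = 0
  bitSum (f ∷ fs) x = bit (f x) + bitSum fs x

  countSum-[] : ∀ fs → countSum fs [] ≡ 0
  countSum-[] []       = refl
  countSum-[] (f ∷ fs) = countSum-[] fs

  countSum-∷ : ∀ fs x xs → countSum fs (x ∷ xs) ≡ bitSum fs x + countSum fs xs
  countSum-∷ []       x xs = refl
  countSum-∷ (f ∷ fs) x xs = begin
    (bit (f x) + count f xs) + countSum fs (x ∷ xs)
      ≡⟨ cong (_+_ (bit (f x) + count f xs)) (countSum-∷ fs x xs) ⟩
    (bit (f x) + count f xs) + (bitSum fs x + countSum fs xs)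
      ≡⟨ interchange (bit (f x)) (count f xs) (bitSum fs x) (countSum fs xs) ⟩
    (bit (f x) + bitSum fs x) + (count f xs + countSum fs xs) ∎
    where open ≡-Reasoning

  countSum-pointwise : ∀ {P : A → Set} (fs gs : List (A → Bool)) →
    (∀ x → P x → bitSum fs x ≡ bitSum gs x) → ∀ {xs} → All P xs → countSum fs xs ≡ countSum gs xs
  countSum-pointwise fs gs eq {[]} [] = trans (countSum-[] fs) (sym (countSum-[] gs))
  countSum-pointwise fs gs eq {x ∷ xs} (px ∷ pxs) = begin
    countSum fs (x ∷ xs)            ≡⟨ countSum-∷ fs x xs ⟩
    bitSum fs x + countSum fs xs    ≡⟨ cong₂ _+_ (eq x px) (countSum-pointwise fs gs eq pxs) ⟩
    bitSum gs x + countSum gs xs    ≡⟨ countSum-∷ gs x xs ⟨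
    countSum gs (x ∷ xs)            ∎
    where open ≡-Reasoning

_<ᵇ_ : ℤ → ℤ → Bool
x <ᵇ y = does (x ℤ.<? y)

infix 5 _<ᵇ_

<ᵇ-true : ∀ {x y} → x ℤ.< y → x <ᵇ y ≡ true
<ᵇ-true {x} {y} = dec-true (x ℤ.<? y)

<ᵇ-false : ∀ {x y} → y ℤ.≤ x → x <ᵇ y ≡ false
<ᵇ-false {x} {y} y≤x = dec-false (x ℤ.<? y) (ℤP.≤⇒≯ y≤x)

<ᵇ-true⁻¹ : ∀ x y → x <ᵇ y ≡ true → x ℤ.< y
<ᵇ-true⁻¹ x y eq with x ℤ.<? y
... | yes x<y = x<y
<ᵇ-true⁻¹ x y () | no _

<ᵇ-false⁻¹ : ∀ x y → x <ᵇ y ≡ false → y ℤ.≤ x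
<ᵇ-false⁻¹ x y eq with x ℤ.<? y
<ᵇ-false⁻¹ x y () | yes _
... | no x≮y = ℤP.≮⇒≥ x≮y

<ᵇ-up : ∀ t x {y} → t <ᵇ x ≡ true → x ℤ.≤ y → t <ᵇ y ≡ true
<ᵇ-up t x t<x x≤y = <ᵇ-true (ℤP.<-≤-trans (<ᵇ-true⁻¹ t x t<x) x≤y)

<-by-difference : ∀ {x y x' y'} → x -ℤ y ≡ x' -ℤ y' → x ℤ.< y → x' ℤ.< y'
<-by-difference {x} {y} {x'} {y'} eq x<y =
  subst₂ ℤ._<_ (shiftˡ x x') shiftʳ (ℤP.+-monoˡ-< (x' -ℤ x) x<y)
  where
  open ≡-Reasoning
  shiftˡ : ∀ x x' → x +ℤ (x' -ℤ x) ≡ x'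
  shiftˡ = solve-∀
  regroup : ∀ x y x' → y +ℤ (x' -ℤ x) ≡ x' -ℤ (x -ℤ y)
  regroup = solve-∀
  cancel : ∀ x' y' → x' -ℤ (x' -ℤ y') ≡ y'
  cancel = solve-∀
  shiftʳ : y +ℤ (x' -ℤ x) ≡ y'
  shiftʳ = begin
    y +ℤ (x' -ℤ x)   ≡⟨ regroup x y x' ⟩
    x' -ℤ (x -ℤ y)   ≡⟨ cong (λ d → x' -ℤ d) eq ⟩
    x' -ℤ (x' -ℤ y') ≡⟨ cancel x' y' ⟩
    y'               ∎

<ᵇ-by-difference : ∀ x y x' y' → x -ℤ y ≡ x' -ℤ y' → (x <ᵇ y) ≡ (x' <ᵇ y')
<ᵇ-by-difference x y x' y' eq =
  does-⇔ (mk⇔ (<-by-difference eq) (<-by-difference (sym eq))) (x ℤ.<? y) (x' ℤ.<? y')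

<ᵇ-exclusive : ∀ x y → ¬ x ≡ y → bit (x <ᵇ y) + bit (y <ᵇ x) ≡ 1
<ᵇ-exclusive x y x≢y with ℤP.<-cmp x y
... | tri< x<y _ _ rewrite <ᵇ-true x<y | <ᵇ-false (ℤP.<⇒≤ x<y) = refl
... | tri≈ _ x≡y _ = ⊥-elim (x≢y x≡y)
... | tri> _ _ y<x rewrite <ᵇ-false (ℤP.<⇒≤ y<x) | <ᵇ-true y<x = refl

<ᵇ-flip : ∀ x y → ¬ x ≡ y → not (x <ᵇ y) ≡ (y <ᵇ x)
<ᵇ-flip x y x≢y with ℤP.<-cmp x y
... | tri< x<y _ _ rewrite <ᵇ-true x<y | <ᵇ-false (ℤP.<⇒≤ x<y) = refl
... | tri≈ _ x≡y _ = ⊥-elim (x≢y x≡y)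
... | tri> _ _ y<x rewrite <ᵇ-false (ℤP.<⇒≤ y<x) | <ᵇ-true y<x = refl

pred≡ : ∀ r → ℤ.pred r ≡ r -ℤ + 1
pred≡ r = ℤP.+-comm ℤ.-1ℤ r

<ᵇ-predˡ : ∀ r x → (r -ℤ + 1 <ᵇ x) ≡ not (x <ᵇ r)
<ᵇ-predˡ r x with x <ᵇ r in eq
... | true  = <ᵇ-false (subst (x ℤ.≤_) (pred≡ r) (ℤP.i<j⇒i≤pred[j] (<ᵇ-true⁻¹ x r eq)))
... | false = <ᵇ-true (ℤP.<-≤-trans (subst (ℤ._< r) (pred≡ r) (ℤP.i≤pred[j]⇒i<j ℤP.≤-refl)) (<ᵇ-false⁻¹ x r eq))

lookupℤ : List ℤ → ℕ → ℤ
lookupℤ []       _       = 0ℤ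
lookupℤ (x ∷ xs) zero    = x
lookupℤ (x ∷ xs) (suc j) = lookupℤ xs j

module RankWalk (m n : ℕ) where
  open ≡-Reasoning

  δ : Step → ℤ
  δ N = + m
  δ E = - (+ n)

  -- A step together with the rank of its starting point.
  RankedStep : Set
  RankedStep = Step × ℤ

  endOf : RankedStep → ℤ
  endOf (s , a) = a +ℤ δ s

  walk : ℤ → Path → List RankedStep
  walk r []      = []
  walk r (s ∷ p) = (s , r) ∷ walk (r +ℤ δ s) p

  endRank : ℤ → Path → ℤ
  endRank r []      = r
  endRank r (s ∷ p) = endRank (r +ℤ δ s) p

  ranks startRanks laterRanks : ℤ → Path → List ℤ
  ranks r []      = r ∷ []
  ranks r (s ∷ p) = r ∷ ranks (r +ℤ δ s) p
  startRanks r []      = []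
  startRanks r (s ∷ p) = r ∷ startRanks (r +ℤ δ s) p
  laterRanks r []      = []
  laterRanks r (s ∷ p) = ranks (r +ℤ δ s) p

  walk-++ : ∀ r p q → walk r (p ++ q) ≡ walk r p ++ walk (endRank r p) q
  walk-++ r []      q = refl
  walk-++ r (s ∷ p) q = cong ((s , r) ∷_) (walk-++ (r +ℤ δ s) p q)

  endRank-++ : ∀ r p q → endRank r (p ++ q) ≡ endRank (endRank r p) q
  endRank-++ r []      q = refl
  endRank-++ r (s ∷ p) q = endRank-++ (r +ℤ δ s) p q

  ranks-++ : ∀ r p q → ranks r (p ++ q) ≡ startRanks r p ++ ranks (endRank r p) q
  ranks-++ r []      q = refl
  ranks-++ r (s ∷ p) q = cong (r ∷_) (ranks-++ (r +ℤ δ s) p q)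

  ranks-snoc : ∀ r p → ranks r p ≡ startRanks r p ++ (endRank r p ∷ [])
  ranks-snoc r []      = refl
  ranks-snoc r (s ∷ p) = cong (r ∷_) (ranks-snoc (r +ℤ δ s) p)

  displacement : Path → ℤ
  displacement []      = 0ℤ
  displacement (s ∷ p) = δ s +ℤ displacement p

  endRank-displacement : ∀ r p → endRank r p ≡ r +ℤ displacement p
  endRank-displacement r []      = sym (ℤP.+-identityʳ r)
  endRank-displacement r (s ∷ p) =
    trans (endRank-displacement (r +ℤ δ s) p) (ℤP.+-assoc r (δ s) (displacement p))

  displacement-++ : ∀ p q → displacement (p ++ q) ≡ displacement p +ℤ displacement q
  displacement-++ []      q = sym (ℤP.+-identityˡ (displacement q))
  displacement-++ (s ∷ p) q =
    trans (cong (λ z → δ s +ℤ z) (displacement-++ p q)) (sym (ℤP.+-assoc (δ s) (displacement p) (displacement q)))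

  displacement-reverse : ∀ p → displacement (reverse p) ≡ displacement p
  displacement-reverse []      = refl
  displacement-reverse (s ∷ p) = begin
    displacement (reverse (s ∷ p))          ≡⟨ cong displacement (unfold-reverse s p) ⟩
    displacement (reverse p ++ s ∷ [])      ≡⟨ displacement-++ (reverse p) (s ∷ []) ⟩
    displacement (reverse p) +ℤ (δ s +ℤ 0ℤ) ≡⟨ cong₂ _+ℤ_ (displacement-reverse p) (ℤP.+-identityʳ (δ s)) ⟩
    displacement p +ℤ δ s                   ≡⟨ ℤP.+-comm (displacement p) (δ s) ⟩
    δ s +ℤ displacement p                   ∎

  endRank-reverse : ∀ r p → endRank r (reverse p) ≡ endRank r p
  endRank-reverse r p = begin
    endRank r (reverse p)         ≡⟨ endRank-displacement r (reverse p) ⟩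
    r +ℤ displacement (reverse p) ≡⟨ cong (λ z → r +ℤ z) (displacement-reverse p) ⟩
    r +ℤ displacement p           ≡⟨ endRank-displacement r p ⟨
    endRank r p                   ∎

  -- A step traversed backwards on the rank line reflected through K/2: a step from
  -- rank a to a + δ s becomes the same kind of step from K - a - δ s to K - a.
  reflect : ℤ → RankedStep → RankedStep
  reflect K (s , a) = (s , (K -ℤ a) -ℤ δ s)

  walk-reverse : ∀ x y p → walk y (reverse p) ≡ reverse (map (reflect (y +ℤ endRank x p)) (walk x p))
  walk-reverse x y []      = refl
  walk-reverse x y (s ∷ p) = begin
    walk y (reverse (s ∷ p))                        ≡⟨ cong (walk y) (unfold-reverse s p) ⟩
    walk y (reverse p ++ s ∷ [])                    ≡⟨ walk-++ y (reverse p) (s ∷ []) ⟩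
    walk y (reverse p) ++ (s , endRank y (reverse p)) ∷ []
      ≡⟨ cong₂ _++_ (walk-reverse (x +ℤ δ s) y p) (cong (λ z → (s , z) ∷ []) lastStart) ⟩
    reverse (map (reflect K) (walk (x +ℤ δ s) p)) ++ reflect K (s , x) ∷ []
      ≡⟨ unfold-reverse (reflect K (s , x)) (map (reflect K) (walk (x +ℤ δ s) p)) ⟨
    reverse (map (reflect K) (walk x (s ∷ p)))      ∎
    where
    K : ℤ
    K = y +ℤ endRank x (s ∷ p)
    rearrange : ∀ y t x d → y +ℤ t ≡ (y +ℤ ((x +ℤ d) +ℤ t) -ℤ x) -ℤ d
    rearrange = solve-∀
    lastStart : endRank y (reverse p) ≡ (K -ℤ x) -ℤ δ s
    lastStart = begin
      endRank y (reverse p) ≡⟨ endRank-reverse y p ⟩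
      endRank y p           ≡⟨ endRank-displacement y p ⟩
      y +ℤ displacement p   ≡⟨ rearrange y (displacement p) x (δ s) ⟩
      (y +ℤ ((x +ℤ δ s) +ℤ displacement p) -ℤ x) -ℤ δ s
        ≡⟨ cong (λ z → (y +ℤ z -ℤ x) -ℤ δ s) (endRank-displacement (x +ℤ δ s) p) ⟨
      (y +ℤ endRank (x +ℤ δ s) p -ℤ x) -ℤ δ s ∎

  m+n : ℤ
  m+n = + (m + n)

  inWindow : ℤ → Bool
  inWindow d = (0ℤ <ᵇ d) ∧ (d <ᵇ m+n)

  inWindow-mirror : ∀ d → inWindow (m+n -ℤ d) ≡ inWindow d
  inWindow-mirror d =
    trans (cong₂ _∧_ (<ᵇ-by-difference 0ℤ (m+n -ℤ d) d m+n (lower d m+n)) (<ᵇ-by-difference (m+n -ℤ d) m+n 0ℤ d (upper d m+n)))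
          (∧-comm (d <ᵇ m+n) (0ℤ <ᵇ d))
    where
    lower : ∀ d w → 0ℤ -ℤ (w -ℤ d) ≡ d -ℤ w
    lower = solve-∀
    upper : ∀ d w → (w -ℤ d) -ℤ w ≡ 0ℤ -ℤ d
    upper = solve-∀

  dinvPair : RankedStep → RankedStep → Bool
  dinvPair (E , a) (N , b) = inWindow (a -ℤ b)
  dinvPair (E , _) (E , _) = false
  dinvPair (N , _) _       = false

  dinvPairᵒ : RankedStep → RankedStep → Bool
  dinvPairᵒ x y = dinvPair y x

  Balanced : ℤ → Path → Set
  Balanced r p = pairs dinvPair (walk r p) ≡ pairs dinvPairᵒ (walk r p)

  -- Reflection preserves dinv pairs: it maps the rank difference d to m + n - d.
  dinvPair-reflect : ∀ K x y → dinvPair (reflect K x) (reflect K y) ≡ dinvPair x y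
  dinvPair-reflect K (E , a) (N , b) = trans (cong inWindow difference) (inWindow-mirror (a -ℤ b))
    where
    rearrange : ∀ K a b M N → ((K -ℤ a) -ℤ (- N)) -ℤ ((K -ℤ b) -ℤ M) ≡ (M +ℤ N) -ℤ (a -ℤ b)
    rearrange = solve-∀
    difference : ((K -ℤ a) -ℤ δ E) -ℤ ((K -ℤ b) -ℤ δ N) ≡ m+n -ℤ (a -ℤ b)
    difference = trans (rearrange K a b (+ m) (+ n)) (cong (λ z → z -ℤ (a -ℤ b)) (sym (ℤP.pos-+ m n)))
  dinvPair-reflect K (E , a) (E , b) = refl
  dinvPair-reflect K (N , a) y       = refl

  ranks-head : ∀ {P : ℤ → Set} r p → All P (ranks r p) → P r
  ranks-head r []      (pr ∷ _) = pr
  ranks-head r (s ∷ p) (pr ∷ _) = pr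

  ranks-last : ∀ {P : ℤ → Set} r p → All P (ranks r p) → P (endRank r p)
  ranks-last r []      (pr ∷ _)   = pr
  ranks-last r (s ∷ p) (_ ∷ prs) = ranks-last (r +ℤ δ s) p prs

  ranks⇒steps : ∀ {P : ℤ → Set} r p → All P (ranks r p) → All (λ st → P (proj₂ st) × P (endOf st)) (walk r p)
  ranks⇒steps r []      _          = []
  ranks⇒steps r (s ∷ p) (pr ∷ prs) = (pr , ranks-head (r +ℤ δ s) p prs) ∷ ranks⇒steps (r +ℤ δ s) p prs

  laterRanks⇒ends : ∀ {P : ℤ → Set} r p → All P (laterRanks r p) → All (λ st → P (endOf st)) (walk r p)
  laterRanks⇒ends r []      _   = []
  laterRanks⇒ends r (s ∷ p) prs =
    ranks-head (r +ℤ δ s) p prs ∷ All.map proj₂ (ranks⇒steps (r +ℤ δ s) p prs)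

  startRanks⇒starts : ∀ {P : ℤ → Set} r p → All P (startRanks r p) → All (λ st → P (proj₂ st)) (walk r p)
  startRanks⇒starts r []      _          = []
  startRanks⇒starts r (s ∷ p) (pr ∷ prs) = pr ∷ startRanks⇒starts (r +ℤ δ s) p prs

  Distinct : ℤ → Path → Set
  Distinct r p = AllPairs (λ x y → ¬ x ≡ y) (ranks r p)

  distinct-first : ∀ r p → Distinct r p → All (λ y → ¬ r ≡ y) (laterRanks r p)
  distinct-first r []      _       = []
  distinct-first r (s ∷ p) (h ∷ _) = h

  distinct-last : ∀ r p → Distinct r p → All (λ y → ¬ y ≡ endRank r p) (startRanks r p)
  distinct-last r []      _       = []
  distinct-last r (s ∷ p) (h ∷ d) = ranks-last (r +ℤ δ s) p h ∷ distinct-last (r +ℤ δ s) p d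

  lookup-ranks : ∀ r p k → k ≤ length p → lookupℤ (ranks r p) k ≡ endRank r (take k p)
  lookup-ranks r []      zero    _         = refl
  lookup-ranks r (s ∷ p) zero    _         = refl
  lookup-ranks r (s ∷ p) (suc k) (s≤s k≤l) = lookup-ranks (r +ℤ δ s) p k k≤l

  ranks-cons : ∀ r p → ranks r p ≡ r ∷ laterRanks r p
  ranks-cons r []      = refl
  ranks-cons r (s ∷ p) = refl

  length-laterRanks : ∀ r p → length (laterRanks r p) ≡ length p
  length-laterRanks r []      = refl
  length-laterRanks r (s ∷ p) = length-ranks (r +ℤ δ s) p
    where
    length-ranks : ∀ r p → length (ranks r p) ≡ suc (length p)
    length-ranks r []      = refl
    length-ranks r (s ∷ p) = cong suc (length-ranks (r +ℤ δ s) p)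

  ranks-split : ∀ {P : ℤ → Set} r p q → All P (ranks r (p ++ q)) → All P (ranks r p) × All P (ranks (endRank r p) q)
  ranks-split {P} r p q all =
    subst (All P) (sym (ranks-snoc r p)) (AllP.++⁺ firstPart (ranks-head (endRank r p) q secondPart ∷ [])) ,
    secondPart
    where
    all′ : All P (startRanks r p ++ ranks (endRank r p) q)
    all′ = subst (All P) (ranks-++ r p q) all
    firstPart : All P (startRanks r p)
    firstPart = AllP.++⁻ˡ (startRanks r p) all′
    secondPart : All P (ranks (endRank r p) q)
    secondPart = AllP.++⁻ʳ (startRanks r p) all′

-- a ≡ b follows from a + s ≡ b + t once t ≡ s: the way linear equations between
-- counts are added up below (the first equation is a ring identity).
cancel-sum : ∀ {a b s t} → a + s ≡ b + t → t ≡ s → a ≡ b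
cancel-sum {a} {b} {s} eq refl = ℕP.+-cancelʳ-≡ s a b eq

module Balance (m n : ℕ) (m>0 : 0 ℕ.< m) (n>0 : 0 ℕ.< n) where
  open RankWalk m n

  i<i+m : ∀ i → i ℤ.< i +ℤ + m
  i<i+m i = subst (ℤ._< i +ℤ + m) (ℤP.+-identityʳ i) (ℤP.+-monoʳ-< i (ℤ.+<+ m>0))

  i-n<i : ∀ i → i -ℤ + n ℤ.< i
  i-n<i i = subst (i -ℤ + n ℤ.<_) (ℤP.+-identityʳ i) (ℤP.+-monoʳ-< i (ℤP.neg-mono-< (ℤ.+<+ n>0)))

  crossesUp crossesDown : ℤ → RankedStep → Bool
  crossesUp t (N , a)   = (t <ᵇ a +ℤ + m) ∧ not (t <ᵇ a)
  crossesUp t (E , a)   = false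
  crossesDown t (E , a) = (t <ᵇ a) ∧ not (t <ᵇ a -ℤ + n)
  crossesDown t (N , a) = false

  level-crossings : ∀ W r t →
    count (crossesUp t) (walk r W) + bit (t <ᵇ r) ≡ count (crossesDown t) (walk r W) + bit (t <ᵇ endRank r W)
  level-crossings []      r t = refl
  level-crossings (s ∷ W) r t =
    combine (bit (crossesUp t (s , r))) (count (crossesUp t) L) (bit (t <ᵇ r))
            (bit (crossesDown t (s , r))) (bit (t <ᵇ r +ℤ δ s)) (count (crossesDown t) L)
            (bit (t <ᵇ endRank (r +ℤ δ s) W))
            (step s r) (level-crossings W (r +ℤ δ s) t)
    where
    step : ∀ s a → bit (crossesUp t (s , a)) + bit (t <ᵇ a) ≡ bit (crossesDown t (s , a)) + bit (t <ᵇ a +ℤ δ s)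
    step N a with t <ᵇ a in t<a
    ... | true  rewrite <ᵇ-up t a t<a (ℤP.i≤i+j a (+ m)) = refl
    ... | false rewrite ∧-identityʳ (t <ᵇ a +ℤ + m) = ℕP.+-identityʳ _
    step E a with t <ᵇ a -ℤ + n in t<a-n
    ... | true  rewrite <ᵇ-up t (a -ℤ + n) t<a-n (ℤP.i-j≤i a (+ n)) = refl
    ... | false rewrite ∧-identityʳ (t <ᵇ a) = sym (ℕP.+-identityʳ _)
    L : List RankedStep
    L = walk (r +ℤ δ s) W
    combine : ∀ a b c d e f g → a + c ≡ d + e → b + e ≡ f + g → (a + b) + c ≡ (d + f) + g
    combine a b c d e f g h₁ h₂ = cancel-sum (linear a b c d e f g) (cong₂ _+_ h₁ h₂)
      where
      linear : ∀ a b c d e f g → ((a + b) + c) + ((d + e) + (f + g)) ≡ ((d + f) + g) + ((a + c) + (b + e))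
      linear = ℕ-Ring.solve-∀

  nStartAbove eEndAbove eStartBelow nEndBelow : ℤ → RankedStep → Bool
  nStartAbove t (N , a) = t <ᵇ a
  nStartAbove t (E , a) = false
  eEndAbove t (E , a)   = t <ᵇ a -ℤ + n
  eEndAbove t (N , a)   = false
  eStartBelow t (E , a) = a <ᵇ t
  eStartBelow t (N , a) = false
  nEndBelow t (N , a)   = a +ℤ + m <ᵇ t
  nEndBelow t (E , a)   = false

  m+n≡ : m+n ≡ + m +ℤ + n
  m+n≡ = ℤP.pos-+ m n

  shift : ∀ a r c → (a +ℤ c) -ℤ (r +ℤ c) ≡ a -ℤ r
  shift = solve-∀
  negate : ∀ a r → 0ℤ -ℤ (a -ℤ r) ≡ r -ℤ a
  negate = solve-∀
  swap : ∀ a r x y → (a -ℤ r) -ℤ (x +ℤ y) ≡ (a -ℤ y) -ℤ (r +ℤ x)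
  swap = solve-∀

  -- Contribution of a later step (s , a) when the walk begins with an N step at
  -- rank r: its dinv pairs with that first step are accounted for by boundary terms
  -- and by the crossings of the level r.
  afterN : ∀ r s a → ¬ r ≡ a → ¬ r ≡ a +ℤ δ s → ¬ r +ℤ + m ≡ a +ℤ δ s →
    bitSum (eEndAbove r ∷ nEndBelow (r +ℤ + m) ∷ crossesDown r ∷ []) (s , a) ≡
    bitSum ((λ y → dinvPair y (N , r)) ∷ nEndBelow r ∷ eEndAbove (r +ℤ + m) ∷ crossesUp r ∷ []) (s , a)
  afterN r N a r≢a r≢a+m _ rewrite <ᵇ-by-difference (a +ℤ + m) (r +ℤ + m) a r (shift a r (+ m))
    with ℤP.<-cmp a r
  ... | tri< a<r _ _ rewrite <ᵇ-true a<r | <ᵇ-false (ℤP.<⇒≤ a<r) | ∧-identityʳ (r <ᵇ a +ℤ + m) =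
    sym (trans (cong (λ z → bit (a +ℤ + m <ᵇ r) + z) (ℕP.+-identityʳ _)) (<ᵇ-exclusive (a +ℤ + m) r (λ e → r≢a+m (sym e))))
  ... | tri≈ _ a≡r _ = ⊥-elim (r≢a (sym a≡r))
  ... | tri> _ _ r<a rewrite <ᵇ-false (ℤP.<⇒≤ r<a) | <ᵇ-true r<a | ∧-zeroʳ (r <ᵇ a +ℤ + m)
                           | <ᵇ-false (ℤP.<⇒≤ (ℤP.<-≤-trans r<a (ℤP.i≤i+j a (+ m)))) = refl
  afterN r E a _ _ r+m≢a-n
    rewrite <ᵇ-by-difference 0ℤ (a -ℤ r) r a (negate a r)
          | <ᵇ-by-difference (a -ℤ r) m+n (a -ℤ + n) (r +ℤ + m) (trans (cong (λ z → (a -ℤ r) -ℤ z) m+n≡) (swap a r (+ m) (+ n)))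
    with r <ᵇ a -ℤ + n in r<a-n
  ... | true rewrite <ᵇ-up r (a -ℤ + n) r<a-n (ℤP.i-j≤i a (+ n)) =
    sym (trans (cong (λ z → bit (a -ℤ + n <ᵇ r +ℤ + m) + z) (ℕP.+-identityʳ _))
               (<ᵇ-exclusive (a -ℤ + n) (r +ℤ + m) (λ e → r+m≢a-n (sym e))))
  ... | false rewrite <ᵇ-true (ℤP.≤-<-trans (<ᵇ-false⁻¹ r (a -ℤ + n) r<a-n) (i<i+m r))
                    | <ᵇ-false (ℤP.≤-trans (<ᵇ-false⁻¹ r (a -ℤ + n) r<a-n) (ℤP.i≤i+j r (+ m))) = refl

  -- Contribution of a later step (s , a) when the walk begins with an E step at
  -- rank r, relative to the level r - 1 (the last integer level the E step crosses).
  afterE : ∀ r s a → ¬ r ≡ a → ¬ r ≡ a +ℤ δ s → ¬ r -ℤ + n ≡ a +ℤ δ s →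
    bitSum (dinvPair (E , r) ∷ eEndAbove r ∷ nEndBelow (r -ℤ + n) ∷ crossesDown (r -ℤ + 1) ∷ []) (s , a) ≡
    bitSum (nEndBelow r ∷ eEndAbove (r -ℤ + n) ∷ crossesUp (r -ℤ + 1) ∷ []) (s , a)
  afterE r N a _ _ r-n≢a+m
    rewrite <ᵇ-predˡ r (a +ℤ + m) | <ᵇ-predˡ r a
          | <ᵇ-by-difference 0ℤ (r -ℤ a) a r (negate r a)
          | <ᵇ-by-difference (r -ℤ a) m+n (r -ℤ + n) (a +ℤ + m) (trans (cong (λ z → (r -ℤ a) -ℤ z) m+n≡) (swap r a (+ m) (+ n)))
    with a <ᵇ r in a<r
  ... | true  = trans (trans (cong (λ z → bit (r -ℤ + n <ᵇ a +ℤ + m) + z) (ℕP.+-identityʳ _))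
                             (<ᵇ-exclusive (r -ℤ + n) (a +ℤ + m) r-n≢a+m))
                      (sym (one-of-two (a +ℤ + m <ᵇ r)))
    where
    one-of-two : ∀ b → bit b + (bit (not b ∧ true) + 0) ≡ 1
    one-of-two true  = refl
    one-of-two false = refl
  ... | false
    rewrite <ᵇ-false (ℤP.≤-trans (<ᵇ-false⁻¹ a r a<r) (ℤP.i≤i+j a (+ m)))
          | <ᵇ-false (ℤP.≤-trans (ℤP.i-j≤i r (+ n)) (ℤP.≤-trans (<ᵇ-false⁻¹ a r a<r) (ℤP.i≤i+j a (+ m)))) = refl
  afterE r E a r≢a r≢a-n _
    rewrite <ᵇ-predˡ r a | <ᵇ-predˡ r (a -ℤ + n)
          | <ᵇ-by-difference (r -ℤ + n) (a -ℤ + n) r a (shift r a (- + n))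
    with r <ᵇ a -ℤ + n in r<a-n
  ... | true
    rewrite <ᵇ-false (ℤP.<⇒≤ (<ᵇ-true⁻¹ r (a -ℤ + n) r<a-n))
          | <ᵇ-up r (a -ℤ + n) r<a-n (ℤP.i-j≤i a (+ n)) | ∧-zeroʳ (not (a <ᵇ r)) = refl
  ... | false
    rewrite <ᵇ-true (ℤP.≤∧≢⇒< (<ᵇ-false⁻¹ r (a -ℤ + n) r<a-n) (λ e → r≢a-n (sym e)))
          | ∧-identityʳ (not (a <ᵇ r)) | <ᵇ-flip a r (λ e → r≢a (sym e)) = refl

  combineN : ∀ P P' A₁ A₃ E₀ E₁ B₀ B₁ C U D g h →
    P + (A₁ + E₁) ≡ P' + (A₃ + B₁) →
    E₀ + (B₁ + (D + 0)) ≡ C + (B₀ + (E₁ + (U + 0))) →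
    U + 1 ≡ D + h →
    g + h ≡ 1 →
    P + ((g + A₁) + E₀) ≡ (C + P') + (A₃ + B₀)
  combineN P P' A₁ A₃ E₀ E₁ B₀ B₁ C U D g h ih pw lv ex =
    cancel-sum (linear P P' A₁ A₃ E₀ E₁ B₀ B₁ C U D g h)
               (cong₂ _+_ (cong₂ _+_ ih pw) (cong₂ _+_ lv ex))
    where
    linear : ∀ P P' A₁ A₃ E₀ E₁ B₀ B₁ C U D g h →
      (P + ((g + A₁) + E₀)) + (((P' + (A₃ + B₁)) + (C + (B₀ + (E₁ + (U + 0))))) + ((D + h) + 1)) ≡
      ((C + P') + (A₃ + B₀)) + (((P + (A₁ + E₁)) + (E₀ + (B₁ + (D + 0)))) + ((U + 1) + (g + h)))
    linear = ℕ-Ring.solve-∀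

  combineE : ∀ P P' A₁ A₃ E₀ E₁ B₀ B₁ C U D h →
    P + (A₁ + E₁) ≡ P' + (A₃ + B₁) →
    C + (E₀ + (B₁ + (D + 0))) ≡ B₀ + (E₁ + (U + 0)) →
    U + 0 ≡ D + h →
    (C + P) + (A₁ + E₀) ≡ P' + ((h + A₃) + B₀)
  combineE P P' A₁ A₃ E₀ E₁ B₀ B₁ C U D h ih pw lv =
    cancel-sum (linear P P' A₁ A₃ E₀ E₁ B₀ B₁ C U D h) (cong₂ _+_ ih (cong₂ _+_ pw lv))
    where
    linear : ∀ P P' A₁ A₃ E₀ E₁ B₀ B₁ C U D h →
      ((C + P) + (A₁ + E₀)) + ((P' + (A₃ + B₁)) + ((B₀ + (E₁ + (U + 0))) + (D + h))) ≡
      (P' + ((h + A₃) + B₀)) + ((P + (A₁ + E₁)) + ((C + (E₀ + (B₁ + (D + 0)))) + (U + 0)))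
    linear = ℕ-Ring.solve-∀

  balance-identity : ∀ W r → Distinct r W →
    let L = walk r W ; e = endRank r W in
    pairs dinvPair L + (count (nStartAbove e) L + count (eEndAbove r) L) ≡
    pairs dinvPairᵒ L + (count (eStartBelow e) L + count (nEndBelow r) L)
  balance-identity []      r _ = refl
  balance-identity (N ∷ W) r (r∉ ∷ distinct)
    rewrite count-false {f = dinvPair (N , r)} (λ _ → refl) (walk (r +ℤ + m) W)
          | <ᵇ-false (ℤP.i≤i+j r (+ m)) =
    combineN (pairs dinvPair L) (pairs dinvPairᵒ L) (count (nStartAbove e) L) (count (eStartBelow e) L)
             (count (eEndAbove r) L) (count (eEndAbove r₁) L) (count (nEndBelow r) L) (count (nEndBelow r₁) L)
             (count (dinvPairᵒ (N , r)) L) (count (crossesUp r) L) (count (crossesDown r) L)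
             (bit (e <ᵇ r)) (bit (r <ᵇ e))
             (balance-identity W r₁ distinct)
             (countSum-pointwise (eEndAbove r ∷ nEndBelow r₁ ∷ crossesDown r ∷ [])
                                 ((λ y → dinvPair y (N , r)) ∷ nEndBelow r ∷ eEndAbove r₁ ∷ crossesUp r ∷ [])
                                 (λ { (s , a) ((r≢a , r≢end) , r₁≢end) → afterN r s a r≢a r≢end r₁≢end })
                                 fresh)
             (subst (λ b → count (crossesUp r) L + bit b ≡ count (crossesDown r) L + bit (r <ᵇ e))
                    (<ᵇ-true (i<i+m r)) (level-crossings W r₁ r))
             (<ᵇ-exclusive e r (λ e≡r → ranks-last r₁ W r∉ (sym e≡r)))
    where
    r₁ e : ℤ
    r₁ = r +ℤ + m
    e = endRank r₁ W
    L : List RankedStep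
    L = walk r₁ W
    fresh : All (λ st → (¬ r ≡ proj₂ st × ¬ r ≡ endOf st) × ¬ r₁ ≡ endOf st) L
    fresh = All.zip (ranks⇒steps r₁ W r∉ , laterRanks⇒ends r₁ W (distinct-first r₁ W distinct))
  balance-identity (E ∷ W) r (r∉ ∷ distinct)
    rewrite count-false {f = dinvPairᵒ (E , r)} (λ { (N , _) → refl ; (E , _) → refl }) (walk (r -ℤ + n) W)
          | <ᵇ-false (ℤP.i-j≤i r (+ n)) =
    combineE (pairs dinvPair L) (pairs dinvPairᵒ L) (count (nStartAbove e) L) (count (eStartBelow e) L)
             (count (eEndAbove r) L) (count (eEndAbove r₁) L) (count (nEndBelow r) L) (count (nEndBelow r₁) L)
             (count (dinvPair (E , r)) L) (count (crossesUp t) L) (count (crossesDown t) L)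
             (bit (r <ᵇ e))
             (balance-identity W r₁ distinct)
             (countSum-pointwise (dinvPair (E , r) ∷ eEndAbove r ∷ nEndBelow r₁ ∷ crossesDown t ∷ [])
                                 (nEndBelow r ∷ eEndAbove r₁ ∷ crossesUp t ∷ [])
                                 (λ { (s , a) ((r≢a , r≢end) , r₁≢end) → afterE r s a r≢a r≢end r₁≢end })
                                 fresh)
             (subst₂ (λ b c → count (crossesUp t) L + bit b ≡ count (crossesDown t) L + bit c)
                     t≮r₁ t<e⇔r<e (level-crossings W r₁ t))
    where
    r₁ t e : ℤ
    r₁ = r -ℤ + n
    t = r -ℤ + 1
    e = endRank r₁ W
    L : List RankedStep
    L = walk r₁ W
    fresh : All (λ st → (¬ r ≡ proj₂ st × ¬ r ≡ endOf st) × ¬ r₁ ≡ endOf st) L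
    fresh = All.zip (ranks⇒steps r₁ W r∉ , laterRanks⇒ends r₁ W (distinct-first r₁ W distinct))
    t≮r₁ : t <ᵇ r₁ ≡ false
    t≮r₁ = trans (<ᵇ-predˡ r r₁) (cong not (<ᵇ-true (i-n<i r)))
    t<e⇔r<e : t <ᵇ e ≡ r <ᵇ e
    t<e⇔r<e = trans (<ᵇ-predˡ r e) (<ᵇ-flip e r (λ e≡r → ranks-last r₁ W r∉ (sym e≡r)))

  balanced-if-boundary : ∀ W r {Q : RankedStep → Set} → Distinct r W →
    (∀ st → Q st → bitSum (nStartAbove (endRank r W) ∷ eEndAbove r ∷ []) st
                  ≡ bitSum (eStartBelow (endRank r W) ∷ nEndBelow r ∷ []) st) →
    All Q (walk r W) → Balanced r W
  balanced-if-boundary W r distinct boundary qs =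
    ℕP.+-cancelʳ-≡ _ _ _ (trans (balance-identity W r distinct) (cong (λ z → pairs dinvPairᵒ L + z) (sym boundaries)))
    where
    L : List RankedStep
    L = walk r W
    e : ℤ
    e = endRank r W
    boundaries : count (nStartAbove e) L + count (eEndAbove r) L ≡ count (eStartBelow e) L + count (nEndBelow r) L
    boundaries = begin
      count (nStartAbove e) L + count (eEndAbove r) L
        ≡⟨ cong (λ z → count (nStartAbove e) L + z) (ℕP.+-identityʳ _) ⟨
      countSum (nStartAbove e ∷ eEndAbove r ∷ []) L
        ≡⟨ countSum-pointwise (nStartAbove e ∷ eEndAbove r ∷ []) (eStartBelow e ∷ nEndBelow r ∷ []) boundary qs ⟩
      countSum (eStartBelow e ∷ nEndBelow r ∷ []) L
        ≡⟨ cong (λ z → count (eStartBelow e) L + z) (ℕP.+-identityʳ _) ⟩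
      count (eStartBelow e) L + count (nEndBelow r) L ∎
      where open ≡-Reasoning

  StepBounds : ℤ → ℤ → ℤ → ℤ → RankedStep → Set
  StepBounds lo hi r e st =
    ((lo ℤ.≤ proj₂ st × proj₂ st ℤ.≤ hi) × (lo ℤ.≤ endOf st × endOf st ℤ.≤ hi)) ×
    (¬ proj₂ st ≡ e × ¬ r ≡ endOf st)

  stepBounds : ∀ W r lo hi → Distinct r W → All (λ x → lo ℤ.≤ x × x ℤ.≤ hi) (ranks r W) →
    All (StepBounds lo hi r (endRank r W)) (walk r W)
  stepBounds W r lo hi distinct bounds =
    All.zip (ranks⇒steps r W bounds ,
             All.zip (startRanks⇒starts r W (distinct-last r W distinct) ,
                      laterRanks⇒ends r W (distinct-first r W distinct)))

  balanced-ascending : ∀ W r → Distinct r W →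
    All (λ x → r ℤ.≤ x × x ℤ.≤ endRank r W) (ranks r W) → Balanced r W
  balanced-ascending W r distinct bounds =
    balanced-if-boundary W r distinct (boundary r (endRank r W)) (stepBounds W r r (endRank r W) distinct bounds)
    where
    boundary : ∀ r e st → StepBounds r e r e st →
      bitSum (nStartAbove e ∷ eEndAbove r ∷ []) st ≡ bitSum (eStartBelow e ∷ nEndBelow r ∷ []) st
    boundary r e (N , a) (((_ , a≤e) , (r≤end , _)) , _) rewrite <ᵇ-false a≤e | <ᵇ-false r≤end = refl
    boundary r e (E , a) (((_ , a≤e) , (r≤end , _)) , (a≢e , r≢end))
      rewrite <ᵇ-true (ℤP.≤∧≢⇒< r≤end r≢end) | <ᵇ-true (ℤP.≤∧≢⇒< a≤e a≢e) = refl

  balanced-descending : ∀ W r → Distinct r W →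
    All (λ x → endRank r W ℤ.≤ x × x ℤ.≤ r) (ranks r W) → Balanced r W
  balanced-descending W r distinct bounds =
    balanced-if-boundary W r distinct (boundary r (endRank r W)) (stepBounds W r (endRank r W) r distinct bounds)
    where
    boundary : ∀ r e st → StepBounds e r r e st →
      bitSum (nStartAbove e ∷ eEndAbove r ∷ []) st ≡ bitSum (eStartBelow e ∷ nEndBelow r ∷ []) st
    boundary r e (N , a) (((e≤a , _) , (_ , end≤r)) , (a≢e , r≢end))
      rewrite <ᵇ-true (ℤP.≤∧≢⇒< e≤a (λ e≡a → a≢e (sym e≡a)))
            | <ᵇ-true (ℤP.≤∧≢⇒< end≤r (λ end≡r → r≢end (sym end≡r))) = refl
    boundary r e (E , a) (((e≤a , _) , (_ , end≤r)) , _) rewrite <ᵇ-false end≤r | <ᵇ-false e≤a = refl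

module ReversedPieces (m n : ℕ) where
  open RankWalk m n
  open ≡-Reasoning

  pairs-reflect : ∀ K L → pairs dinvPair (reverse (map (reflect K) L)) ≡ pairs dinvPairᵒ L
  pairs-reflect K L = begin
    pairs dinvPair (reverse (map (reflect K) L))              ≡⟨ pairs-reverse dinvPair (map (reflect K) L) ⟩
    pairs (λ x y → dinvPair y x) (map (reflect K) L)          ≡⟨ pairs-map (λ x y → dinvPair y x) (reflect K) L ⟩
    pairs (λ x y → dinvPair (reflect K y) (reflect K x)) L    ≡⟨ pairs-ext (λ x y → dinvPair-reflect K y x) L ⟩
    pairs dinvPairᵒ L                                         ∎

  cross-reflect : ∀ K A B →
    cross dinvPair (reverse (map (reflect K) A)) (reverse (map (reflect K) B)) ≡ cross dinvPair A B
  cross-reflect K A B = begin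
    cross dinvPair (reverse (map (reflect K) A)) (reverse (map (reflect K) B))
      ≡⟨ cross-reverseˡ dinvPair (map (reflect K) A) _ ⟩
    cross dinvPair (map (reflect K) A) (reverse (map (reflect K) B))
      ≡⟨ cross-reverseʳ dinvPair (map (reflect K) A) _ ⟩
    cross dinvPair (map (reflect K) A) (map (reflect K) B)
      ≡⟨ cross-map dinvPair (reflect K) A B ⟩
    cross (λ x y → dinvPair (reflect K x) (reflect K y)) A B
      ≡⟨ cross-ext (dinvPair-reflect K) A B ⟩
    cross dinvPair A B ∎

  pairs-reverse-pieces : ∀ Q₁ Q₂ → endRank 0ℤ (Q₁ ++ Q₂) ≡ 0ℤ →
    Balanced 0ℤ Q₁ →
    Balanced (endRank 0ℤ Q₁) Q₂ →
    pairs dinvPair (walk 0ℤ (reverse Q₁ ++ reverse Q₂)) ≡ pairs dinvPair (walk 0ℤ (Q₁ ++ Q₂))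
  pairs-reverse-pieces Q₁ Q₂ closed balanced₁ balanced₂ = begin
    pairs dinvPair (walk 0ℤ (reverse Q₁ ++ reverse Q₂))
      ≡⟨ cong (pairs dinvPair) (walk-++ 0ℤ (reverse Q₁) (reverse Q₂)) ⟩
    pairs dinvPair (walk 0ℤ (reverse Q₁) ++ walk M′ (reverse Q₂))
      ≡⟨ cong₂ (λ u v → pairs dinvPair (u ++ v)) (walk-reverse 0ℤ 0ℤ Q₁)
               (trans (walk-reverse M M′ Q₂) (cong (λ K → reverse (map (reflect K) L₂)) sameCentre)) ⟩
    pairs dinvPair (L₁ᵣ ++ L₂ᵣ)
      ≡⟨ pairs-++ dinvPair L₁ᵣ L₂ᵣ ⟩
    (pairs dinvPair L₁ᵣ + pairs dinvPair L₂ᵣ) + cross dinvPair L₁ᵣ L₂ᵣ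
      ≡⟨ cong₂ _+_ (cong₂ _+_ (trans (pairs-reflect K L₁) (sym balanced₁))
                              (trans (pairs-reflect K L₂) (sym balanced₂)))
                   (cross-reflect K L₁ L₂) ⟩
    (pairs dinvPair L₁ + pairs dinvPair L₂) + cross dinvPair L₁ L₂
      ≡⟨ pairs-++ dinvPair L₁ L₂ ⟨
    pairs dinvPair (L₁ ++ L₂)
      ≡⟨ cong (pairs dinvPair) (walk-++ 0ℤ Q₁ Q₂) ⟨
    pairs dinvPair (walk 0ℤ (Q₁ ++ Q₂)) ∎
    where
    M M′ K : ℤ
    M = endRank 0ℤ Q₁
    M′ = endRank 0ℤ (reverse Q₁)
    K = 0ℤ +ℤ M
    L₁ L₂ L₁ᵣ L₂ᵣ : List RankedStep
    L₁ = walk 0ℤ Q₁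
    L₂ = walk M Q₂
    L₁ᵣ = reverse (map (reflect K) L₁)
    L₂ᵣ = reverse (map (reflect K) L₂)
    -- both reversed pieces are reflected through the same centre
    sameCentre : M′ +ℤ endRank M Q₂ ≡ K
    sameCentre = begin
      M′ +ℤ endRank M Q₂ ≡⟨ cong₂ _+ℤ_ (endRank-reverse 0ℤ Q₁) (trans (sym (endRank-++ 0ℤ Q₁ Q₂)) closed) ⟩
      M +ℤ 0ℤ            ≡⟨ ℤP.+-comm M 0ℤ ⟩
      K                  ∎

isE isN : Step → Bool
isE E = true
isE N = false
isN N = true
isN E = false

width height : Path → ℕ
width  = count isE
height = count isN

module _ {A : Set} where

  total : (A → ℕ) → List A → ℕ
  total w []       = 0
  total w (x ∷ xs) = w x + total w xs

  total-cong : ∀ {P : A → Set} {v w : A → ℕ} → (∀ x → P x → v x ≡ w x) →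
               ∀ {xs} → All P xs → total v xs ≡ total w xs
  total-cong v≡w []         = refl
  total-cong v≡w (px ∷ pxs) = cong₂ _+_ (v≡w _ px) (total-cong v≡w pxs)

  total-ext : ∀ {v w : A → ℕ} → (∀ x → v x ≡ w x) → ∀ xs → total v xs ≡ total w xs
  total-ext v≡w []       = refl
  total-ext v≡w (x ∷ xs) = cong₂ _+_ (v≡w x) (total-ext v≡w xs)

  length-filter : ∀ {P : A → Set} (P? : ∀ x → Dec (P x)) xs →
                  length (filter P? xs) ≡ count (λ x → does (P? x)) xs
  length-filter P? []       = refl
  length-filter P? (x ∷ xs) with does (P? x)
  ... | true  = cong suc (length-filter P? xs)
  ... | false = length-filter P? xs

  length-filter² : ∀ {P Q : A → Set} (P? : ∀ x → Dec (P x)) (Q? : ∀ x → Dec (Q x)) xs →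
    length (filter P? (filter Q? xs)) ≡ count (λ x → does (Q? x) ∧ does (P? x)) xs
  length-filter² P? Q? [] = refl
  length-filter² P? Q? (x ∷ xs) with does (Q? x)
  ... | false = length-filter² P? Q? xs
  ... | true with does (P? x)
  ...   | true  = cong suc (length-filter² P? Q? xs)
  ...   | false = length-filter² P? Q? xs

module _ {A B : Set} where

  count-concatMap : ∀ (f : B → Bool) (g : A → List B) xs → count f (concatMap g xs) ≡ total (λ x → count f (g x)) xs
  count-concatMap f g []       = refl
  count-concatMap f g (x ∷ xs) =
    trans (count-++ f (g x) (concat (map g xs))) (cong (_+_ (count f (g x))) (count-concatMap f g xs))

count-applyUpTo : ∀ {A : Set} (f : A → Bool) (g : ℕ → A) k → count f (applyUpTo g k) ≡ count (λ i → f (g i)) (upTo k)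
count-applyUpTo f g zero    = refl
count-applyUpTo f g (suc k) = cong (_+_ (bit (f (g 0))))
  (trans (count-applyUpTo f (λ i → g (suc i)) k) (sym (count-applyUpTo (λ i → f (g i)) suc k)))

total-applyUpTo : ∀ {A : Set} (w : A → ℕ) (g : ℕ → A) k → total w (applyUpTo g k) ≡ total (λ i → w (g i)) (upTo k)
total-applyUpTo w g zero    = refl
total-applyUpTo w g (suc k) = cong (_+_ (w (g 0)))
  (trans (total-applyUpTo w (λ i → g (suc i)) k) (sym (total-applyUpTo (λ i → w (g i)) suc k)))

≤?-suc : ∀ a b → does (suc a ≤? suc b) ≡ does (a ≤? b)
≤?-suc a b = does-⇔ (mk⇔ ℕ.s≤s⁻¹ s≤s) (suc a ≤? suc b) (a ≤? b)

nth-heightsFrom-suc : ∀ h p i → i < width p → nth (heightsFrom (suc h) p) i ≡ suc (nth (heightsFrom h p) i)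
nth-heightsFrom-suc h []      i       ()
nth-heightsFrom-suc h (N ∷ p) i       i<w       = nth-heightsFrom-suc (suc h) p i i<w
nth-heightsFrom-suc h (E ∷ p) zero    _         = refl
nth-heightsFrom-suc h (E ∷ p) (suc i) (s≤s i<w) = nth-heightsFrom-suc h p i i<w

-- Number of columns of q of height at most j; for the path E q this is the arm of
-- the cell in column 0 and row j.
columnsAtMost : Path → ℕ → ℕ
columnsAtMost q j = count (λ i → does (nth (heights q) i ≤? j)) (upTo (width q))

module DinvByColumns (m n : ℕ) where

  dinvIn : ℕ → ℕ → Path → ℕ
  dinvIn k l p = length (filter (λ c → dinvCond? m n (arm k p c) (leg p c)) (cells k l p))

  dinvCell : ℕ → Path → ℕ → ℕ → Bool
  dinvCell k p i j = does (nth (heights p) i ≤? j) ∧ does (dinvCond? m n (arm k p (i , j)) (leg p (i , j)))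

  dinvByColumns : ℕ → ℕ → Path → ℕ
  dinvByColumns k l p = total (λ i → count (dinvCell k p i) (upTo l)) (upTo k)

  dinvIn≡byColumns : ∀ k l p → dinvIn k l p ≡ dinvByColumns k l p
  dinvIn≡byColumns k l p =
    trans (length-filter² (λ c → dinvCond? m n (arm k p c) (leg p c)) _ (concatMap row (upTo k)))
    (trans (count-concatMap _ row (upTo k))
           (total-ext (λ i → count-map _ (i ,_) (upTo l)) (upTo k)))
    where
    row : ℕ → List (ℕ × ℕ)
    row i = map (λ j → (i , j)) (upTo l)

  arm-N : ∀ p i j → arm (width p) (N ∷ p) (i , suc j) ≡ arm (width p) p (i , j)
  arm-N p i j =
    trans (length-filter (λ i' → (i <? i') ×-dec (nth (heights (N ∷ p)) i' ≤? suc j)) (upTo (width p)))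
    (trans (count-cong (λ i' i'<w → cong (does (i <? i') ∧_)
                          (trans (cong (λ h → does (h ≤? suc j)) (nth-heightsFrom-suc 0 p i' i'<w))
                                 (≤?-suc (nth (heights p) i') j)))
                       (AllP.all-upTo (width p)))
           (sym (length-filter (λ i' → (i <? i') ×-dec (nth (heights p) i' ≤? j)) (upTo (width p)))))

  dinvCell-N-bottom : ∀ p i → i < width p → dinvCell (width p) (N ∷ p) i 0 ≡ false
  dinvCell-N-bottom p i i<w rewrite nth-heightsFrom-suc 0 p i i<w = refl

  dinvCell-N-shift : ∀ p i j → i < width p → dinvCell (width p) (N ∷ p) i (suc j) ≡ dinvCell (width p) p i j
  dinvCell-N-shift p i j i<w rewrite arm-N p i j | nth-heightsFrom-suc 0 p i i<w =
    cong (_∧ does (dinvCond? m n (arm (width p) p (i , j)) (j ∸ nth (heights p) i))) (≤?-suc (nth (heights p) i) j)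

  byColumns-N : ∀ p → dinvByColumns (width p) (suc (height p)) (N ∷ p) ≡ dinvByColumns (width p) (height p) p
  byColumns-N p = total-cong
    (λ i i<w → trans (cong₂ _+_ (cong bit (dinvCell-N-bottom p i i<w)) (count-applyUpTo _ suc (height p)))
                     (count-ext (λ j → dinvCell-N-shift p i j i<w) (upTo (height p))))
    (AllP.all-upTo (width p))

  arm-E-shift : ∀ p i j → arm (suc (width p)) (E ∷ p) (suc i , j) ≡ arm (width p) p (i , j)
  arm-E-shift p i j =
    trans (length-filter (λ i' → (suc i <? i') ×-dec (nth (heights (E ∷ p)) i' ≤? j)) (upTo (suc (width p))))
    (trans (count-applyUpTo (λ i' → does (suc i <? i') ∧ does (nth (heights (E ∷ p)) i' ≤? j)) suc (width p))
           (sym (length-filter (λ i' → (i <? i') ×-dec (nth (heights p) i' ≤? j)) (upTo (width p)))))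

  dinvCell-E-shift : ∀ p i j → dinvCell (suc (width p)) (E ∷ p) (suc i) j ≡ dinvCell (width p) p i j
  dinvCell-E-shift p i j =
    cong (λ a → does (nth (heights p) i ≤? j) ∧ does (dinvCond? m n a (j ∸ nth (heights p) i))) (arm-E-shift p i j)

  arm-E-first : ∀ p j → arm (suc (width p)) (E ∷ p) (0 , j) ≡ columnsAtMost p j
  arm-E-first p j =
    trans (length-filter (λ i' → (0 <? i') ×-dec (nth (heights (E ∷ p)) i' ≤? j)) (upTo (suc (width p))))
          (count-applyUpTo (λ i' → does (0 <? i') ∧ does (nth (heights (E ∷ p)) i' ≤? j)) suc (width p))

  byColumns-E : ∀ p → dinvByColumns (suc (width p)) (height p) (E ∷ p) ≡
    count (λ j → does (dinvCond? m n (columnsAtMost p j) j)) (upTo (height p)) + dinvByColumns (width p) (height p) p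
  byColumns-E p = cong₂ _+_
    (count-ext (λ j → cong (λ a → does (dinvCond? m n a j)) (arm-E-first p j)) (upTo (height p)))
    (trans (total-applyUpTo _ suc (width p))
           (total-ext (λ i → count-ext (dinvCell-E-shift p i) (upTo (height p))) (upTo (width p))))

nStepPoints : ℕ → ℕ → Path → List (ℕ × ℕ)
nStepPoints x y []      = []
nStepPoints x y (N ∷ q) = (x , y) ∷ nStepPoints x (suc y) q
nStepPoints x y (E ∷ q) = nStepPoints (suc x) y q

columnsAtMost-N-bottom : ∀ q → columnsAtMost (N ∷ q) 0 ≡ 0
columnsAtMost-N-bottom q =
  trans (count-cong {g = λ _ → false} (λ i i<w → cong (λ h → does (h ≤? 0)) (nth-heightsFrom-suc 0 q i i<w))
                    (AllP.all-upTo (width q)))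
        (count-false (λ _ → refl) (upTo (width q)))

columnsAtMost-N-shift : ∀ q j → columnsAtMost (N ∷ q) (suc j) ≡ columnsAtMost q j
columnsAtMost-N-shift q j = count-cong
  (λ i i<w → trans (cong (λ h → does (h ≤? suc j)) (nth-heightsFrom-suc 0 q i i<w)) (≤?-suc (nth (heights q) i) j))
  (AllP.all-upTo (width q))

columnsAtMost-E : ∀ q j → columnsAtMost (E ∷ q) j ≡ suc (columnsAtMost q j)
columnsAtMost-E q j = cong suc (count-applyUpTo (λ i → does (nth (heights (E ∷ q)) i ≤? j)) suc (width q))

-- Row j of q is met by its N step at the point (columnsAtMost q j , j): summing over
-- the rows is summing over the N steps.
rows≡nSteps : ∀ (g : ℕ → ℕ → Bool) q x₀ y₀ →
  count (λ j → g (x₀ + columnsAtMost q j) (y₀ + j)) (upTo (height q)) ≡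
  count (λ xy → g (proj₁ xy) (proj₂ xy)) (nStepPoints x₀ y₀ q)
rows≡nSteps g []      x₀ y₀ = refl
rows≡nSteps g (N ∷ q) x₀ y₀ = cong₂ _+_
  (cong bit (cong₂ g (trans (cong (_+_ x₀) (columnsAtMost-N-bottom q)) (ℕP.+-identityʳ x₀)) (ℕP.+-identityʳ y₀)))
  (trans (count-applyUpTo (λ j → g (x₀ + columnsAtMost (N ∷ q) j) (y₀ + j)) suc (height q))
  (trans (count-ext (λ j → cong₂ g (cong (_+_ x₀) (columnsAtMost-N-shift q j)) (ℕP.+-suc y₀ j)) (upTo (height q)))
         (rows≡nSteps g q x₀ (suc y₀))))
rows≡nSteps g (E ∷ q) x₀ y₀ = trans
  (count-ext (λ j → cong (λ x → g x (y₀ + j)) (trans (cong (_+_ x₀) (columnsAtMost-E q j)) (ℕP.+-suc x₀ (columnsAtMost q j))))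
             (upTo (height q)))
  (rows≡nSteps g q (suc x₀) y₀)

nStepPoints-bound : ∀ q x₀ y₀ → All (λ xy → proj₁ xy ≤ x₀ + width q) (nStepPoints x₀ y₀ q)
nStepPoints-bound []      x₀ y₀ = []
nStepPoints-bound (N ∷ q) x₀ y₀ = ℕP.m≤m+n x₀ (width q) ∷ nStepPoints-bound q x₀ (suc y₀)
nStepPoints-bound (E ∷ q) x₀ y₀ =
  subst (λ b → All (λ xy → proj₁ xy ≤ b) (nStepPoints (suc x₀) y₀ q)) (sym (ℕP.+-suc x₀ (width q)))
        (nStepPoints-bound q (suc x₀) y₀)

module Ranks (m n : ℕ) where
  open RankWalk m n

  rank-N : ∀ x y → rank m n (x , y) +ℤ + m ≡ rank m n (x , suc y)
  rank-N x y = trans (rearrange (+ (m * y)) (+ (n * x)) (+ m))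
                     (cong (λ z → z -ℤ + (n * x)) (trans (sym (ℤP.pos-+ m (m * y))) (cong +_ (sym (ℕP.*-suc m y)))))
    where
    rearrange : ∀ a b c → (a -ℤ b) +ℤ c ≡ (c +ℤ a) -ℤ b
    rearrange = solve-∀

  rank-E : ∀ x y → rank m n (x , y) -ℤ + n ≡ rank m n (suc x , y)
  rank-E x y = trans (rearrange (+ (m * y)) (+ (n * x)) (+ n))
                     (cong (λ z → + (m * y) -ℤ z) (trans (sym (ℤP.pos-+ n (n * x))) (cong +_ (sym (ℕP.*-suc n x)))))
    where
    rearrange : ∀ a b c → (a -ℤ b) -ℤ c ≡ a -ℤ (c +ℤ b)
    rearrange = solve-∀

  rank-origin : rank m n (0 , 0) ≡ 0ℤ
  rank-origin = cong₂ (λ a b → + a -ℤ + b) (ℕP.*-zeroʳ m) (ℕP.*-zeroʳ n)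

  rank-corner : rank m n (m , n) ≡ 0ℤ
  rank-corner = trans (cong (λ z → + (m * n) -ℤ + z) (ℕP.*-comm n m)) (ℤP.+-inverseʳ (+ (m * n)))

  rank-move : ∀ c s → rank m n c +ℤ δ s ≡ rank m n (move c s)
  rank-move (a , b) N = rank-N a b
  rank-move (a , b) E = rank-E a b

module DinvAsPairs (m n : ℕ) (m>0 : 0 < m) (coprime : Coprime m n) where
  open RankWalk m n
  open DinvByColumns m n
  open Ranks m n

  pairsWithE : ∀ ρ q x₀ y₀ c →
    count (dinvPair (E , ρ)) (walk (c +ℤ rank m n (x₀ , y₀)) q) ≡
    count (λ xy → inWindow (ρ -ℤ (c +ℤ rank m n xy))) (nStepPoints x₀ y₀ q)
  pairsWithE ρ []      x₀ y₀ c = refl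
  pairsWithE ρ (N ∷ q) x₀ y₀ c = cong (λ k → bit (inWindow (ρ -ℤ (c +ℤ rank m n (x₀ , y₀)))) + k)
    (trans (cong (λ r → count (dinvPair (E , ρ)) (walk r q))
                 (trans (ℤP.+-assoc c (rank m n (x₀ , y₀)) (+ m)) (cong (c +ℤ_) (rank-N x₀ y₀))))
           (pairsWithE ρ q x₀ (suc y₀) c))
  pairsWithE ρ (E ∷ q) x₀ y₀ c =
    trans (cong (λ r → count (dinvPair (E , ρ)) (walk r q))
                (trans (ℤP.+-assoc c (rank m n (x₀ , y₀)) (- + n)) (cong (c +ℤ_) (rank-E x₀ y₀))))
          (pairsWithE ρ q (suc x₀) y₀ c)

  <ᵇ-pos : ∀ a b → (+ a <ᵇ + b) ≡ does (a <? b)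
  <ᵇ-pos a b = does-⇔ (mk⇔ ℤP.drop‿+<+ ℤ.+<+) (+ a ℤ.<? + b) (a <? b)

  -- By coprimality, n x = m (y + 1) is impossible for x < m: the weak inequality
  -- in the dinv condition is in fact strict.
  no-boundary-cell : ∀ x y → x < m → ¬ n * x ≡ m * (y + 1)
  no-boundary-cell zero    y _   eq =
    ℕP.<-irrefl (trans (sym (ℕP.*-zeroʳ n)) (trans eq (cong (m *_) (ℕP.+-comm y 1))))
                (ℕP.<-≤-trans m>0 (ℕP.m≤m*n m (suc y)))
  no-boundary-cell (suc x) y x<m eq =
    ℕP.<-irrefl refl (ℕP.<-≤-trans x<m (∣⇒≤ (coprime-divisor coprime (divides (y + 1) (trans eq (ℕP.*-comm m (y + 1)))))))

  pos-*-suc : ∀ a b → + (a * (b + 1)) ≡ + (a * b) +ℤ + a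
  pos-*-suc a b = trans (cong +_ (expand a b)) (ℤP.pos-+ (a * b) a)
    where
    expand : ∀ a b → a * (b + 1) ≡ a * b + a
    expand = ℕ-Ring.solve-∀

  dinvCond-as-window : ∀ ρ x y → x < m → does (dinvCond? m n x y) ≡ inWindow (ρ -ℤ ((ρ -ℤ + n) +ℤ rank m n (x , y)))
  dinvCond-as-window ρ x y x<m = trans (cong₂ _∧_ (sym upper) (sym lower)) (∧-comm (d <ᵇ m+n) (0ℤ <ᵇ d))
    where
    d : ℤ
    d = ρ -ℤ ((ρ -ℤ + n) +ℤ rank m n (x , y))
    rearrange₁ : ∀ ρ N P Q → 0ℤ -ℤ (ρ -ℤ ((ρ -ℤ N) +ℤ (P -ℤ Q))) ≡ P -ℤ (Q +ℤ N)
    rearrange₁ = solve-∀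
    rearrange₂ : ∀ ρ N M P Q → (ρ -ℤ ((ρ -ℤ N) +ℤ (P -ℤ Q))) -ℤ (M +ℤ N) ≡ Q -ℤ (P +ℤ M)
    rearrange₂ = solve-∀
    lower : 0ℤ <ᵇ d ≡ does (m * y <? n * (x + 1))
    lower = trans (<ᵇ-by-difference 0ℤ d (+ (m * y)) (+ (n * (x + 1)))
                    (trans (rearrange₁ ρ (+ n) (+ (m * y)) (+ (n * x))) (cong (λ z → + (m * y) -ℤ z) (sym (pos-*-suc n x)))))
                  (<ᵇ-pos (m * y) (n * (x + 1)))
    upper : d <ᵇ m+n ≡ does (n * x ≤? m * (y + 1))
    upper = trans (<ᵇ-by-difference d m+n (+ (n * x)) (+ (m * (y + 1)))
                    (trans (cong (λ z → d -ℤ z) (ℤP.pos-+ m n))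
                    (trans (rearrange₂ ρ (+ n) (+ m) (+ (m * y)) (+ (n * x))) (cong (λ z → + (n * x) -ℤ z) (sym (pos-*-suc m y))))))
            (trans (<ᵇ-pos (n * x) (m * (y + 1)))
                   (does-⇔ (mk⇔ ℕP.<⇒≤ (λ le → ℕP.≤∧≢⇒< le (no-boundary-cell x y x<m)))
                           (n * x <? m * (y + 1)) (n * x ≤? m * (y + 1))))

  -- The dinv cells in the first column of E p are the dinv pairs of the first step.
  firstColumn : ∀ p ρ → suc (width p) ≤ m →
    count (λ j → does (dinvCond? m n (columnsAtMost p j) j)) (upTo (height p)) ≡ count (dinvPair (E , ρ)) (walk (ρ -ℤ + n) p)
  firstColumn p ρ w<m = begin
    count (λ j → does (dinvCond? m n (columnsAtMost p j) j)) (upTo (height p))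
      ≡⟨ rows≡nSteps (λ x y → does (dinvCond? m n x y)) p 0 0 ⟩
    count (λ xy → does (dinvCond? m n (proj₁ xy) (proj₂ xy))) (nStepPoints 0 0 p)
      ≡⟨ count-cong (λ xy x≤w → dinvCond-as-window ρ (proj₁ xy) (proj₂ xy) (ℕP.<-≤-trans (s≤s x≤w) w<m))
                    (nStepPoints-bound p 0 0) ⟩
    count (λ xy → inWindow (ρ -ℤ ((ρ -ℤ + n) +ℤ rank m n xy))) (nStepPoints 0 0 p)
      ≡⟨ pairsWithE ρ p 0 0 (ρ -ℤ + n) ⟨
    count (dinvPair (E , ρ)) (walk ((ρ -ℤ + n) +ℤ rank m n (0 , 0)) p)
      ≡⟨ cong (λ r → count (dinvPair (E , ρ)) (walk r p)) (trans (cong ((ρ -ℤ + n) +ℤ_) rank-origin) (ℤP.+-identityʳ _)) ⟩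
    count (dinvPair (E , ρ)) (walk (ρ -ℤ + n) p) ∎
    where open ≡-Reasoning

  byColumns≡pairs : ∀ p ρ → width p ≤ m → dinvByColumns (width p) (height p) p ≡ pairs dinvPair (walk ρ p)
  byColumns≡pairs []      ρ _   = refl
  byColumns≡pairs (N ∷ p) ρ w≤m = trans (byColumns-N p) (trans (byColumns≡pairs p (ρ +ℤ + m) w≤m)
    (sym (cong (λ k → k + pairs dinvPair (walk (ρ +ℤ + m) p))
               (count-false {f = dinvPair (N , ρ)} (λ _ → refl) (walk (ρ +ℤ + m) p)))))
  byColumns≡pairs (E ∷ p) ρ w<m = trans (byColumns-E p)
    (cong₂ _+_ (firstColumn p ρ w<m) (byColumns≡pairs p (ρ -ℤ + n) (ℕP.<⇒≤ w<m)))

  dinv≡pairs : ∀ D → width D ≡ m → height D ≡ n → dinv m n D ≡ pairs dinvPair (walk 0ℤ D)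
  dinv≡pairs D w≡m h≡n =
    trans (dinvIn≡byColumns m n D)
          (trans (cong₂ (λ k l → dinvByColumns k l D) (sym w≡m) (sym h≡n)) (byColumns≡pairs D 0ℤ (ℕP.≤-reflexive w≡m)))

module DistinctRanks (m n : ℕ) (m>0 : 0 < m) (coprime : Coprime m n) where
  open RankWalk m n
  open Ranks m n

  instance
    m≢0 : ℕ.NonZero m
    m≢0 = ℕ.>-nonZero m>0

  rank-shift : ∀ a b u v → rank m n (a , b) -ℤ rank m n (a + u , b + v) ≡ + (n * u) -ℤ + (m * v)
  rank-shift a b u v = trans (cong₂ (λ x y → rank m n (a , b) -ℤ (+ x -ℤ + y)) (ℕP.*-distribˡ-+ m b v) (ℕP.*-distribˡ-+ n a u))
    (trans (cong₂ (λ x y → rank m n (a , b) -ℤ (x -ℤ y)) (ℤP.pos-+ (m * b) (m * v)) (ℤP.pos-+ (n * a) (n * u)))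
           (rearrange (+ (m * b)) (+ (n * a)) (+ (m * v)) (+ (n * u))))
    where
    rearrange : ∀ B A V U → (B -ℤ A) -ℤ ((B +ℤ V) -ℤ (A +ℤ U)) ≡ U -ℤ V
    rearrange = solve-∀

  nu≡mv : ∀ a b u v → rank m n (a , b) ≡ rank m n (a + u , b + v) → n * u ≡ m * v
  nu≡mv a b u v same = ℤP.+-injective (ℤP.i-j≡0⇒i≡j _ _ (trans (sym (rank-shift a b u v)) (ℤP.i≡j⇒i-j≡0 same)))

  equal-rank : ∀ a b u v → a + u ≤ m → b + v ≤ n → 0 < u + v →
               rank m n (a , b) ≡ rank m n (a + u , b + v) → (a ≡ 0 × b ≡ 0) × (u ≡ m × v ≡ n)
  equal-rank a b zero v _ _ 0<v same = ⊥-elim (ℕP.<-irrefl (sym v≡0) 0<v)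
    where
    v≡0 : v ≡ 0
    v≡0 = ℕP.m*n≡0⇒m≡0 v m (trans (ℕP.*-comm v m) (sym (trans (sym (ℕP.*-zeroʳ n)) (nu≡mv a b 0 v same))))
  equal-rank a b u@(suc _) v a+u≤m b+v≤n _ same = (a≡0 , b≡0) , (u≡m , v≡n)
    where
    m∣u : m ∣ u
    m∣u = coprime-divisor coprime (divides v (trans (nu≡mv a b u v same) (ℕP.*-comm m v)))
    u≡m : u ≡ m
    u≡m = ℕP.≤-antisym (ℕP.m+n≤o⇒n≤o a a+u≤m) (∣⇒≤ m∣u)
    a≡0 : a ≡ 0
    a≡0 = ℕP.n≤0⇒n≡0 (ℕP.+-cancelʳ-≤ m a 0 (subst (λ z → a + z ≤ m) u≡m a+u≤m))
    v≡n : v ≡ n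
    v≡n = sym (ℕP.*-cancelˡ-≡ n v m (trans (ℕP.*-comm m n) (trans (cong (n *_) (sym u≡m)) (nu≡mv a b u v same))))
    b≡0 : b ≡ 0
    b≡0 = ℕP.n≤0⇒n≡0 (ℕP.+-cancelʳ-≤ n b 0 (subst (λ z → b + z ≤ n) v≡n b+v≤n))


  ordered-equal-rank : ∀ a b c d → a ≤ c → b ≤ d → a + b < c + d → c ≤ m → d ≤ n →
    rank m n (a , b) ≡ rank m n (c , d) → (a ≡ 0 × b ≡ 0) × (c ≡ m × d ≡ n)
  ordered-equal-rank a b c d a≤c b≤d a+b<c+d c≤m d≤n same
    with equal-rank a b (c ∸ a) (d ∸ b) (subst (_≤ m) (sym a+u≡c) c≤m) (subst (_≤ n) (sym b+v≡d) d≤n) 0<u+v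
                    (subst₂ (λ x y → rank m n (a , b) ≡ rank m n (x , y)) (sym a+u≡c) (sym b+v≡d) same)
    where
    a+u≡c : a + (c ∸ a) ≡ c
    a+u≡c = ℕP.m+[n∸m]≡n a≤c
    b+v≡d : b + (d ∸ b) ≡ d
    b+v≡d = ℕP.m+[n∸m]≡n b≤d
    regroup : ∀ a b u v → (a + u) + (b + v) ≡ (a + b) + (u + v)
    regroup = ℕ-Ring.solve-∀
    0<u+v : 0 < (c ∸ a) + (d ∸ b)
    0<u+v = ℕP.+-cancelˡ-< (a + b) 0 _
      (subst₂ _<_ (sym (ℕP.+-identityʳ (a + b))) (trans (sym (cong₂ _+_ a+u≡c b+v≡d)) (regroup a b (c ∸ a) (d ∸ b))) a+b<c+d)
  ... | (a≡0 , b≡0) , (u≡m , v≡n) =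
    (a≡0 , b≡0) , (trans (sym (ℕP.m+[n∸m]≡n a≤c)) (cong₂ _+_ a≡0 u≡m) ,
                   trans (sym (ℕP.m+[n∸m]≡n b≤d)) (cong₂ _+_ b≡0 v≡n))

  endRank-rank : ∀ c₁ c₂ p → endRank (rank m n (c₁ , c₂)) p ≡ rank m n (c₁ + width p , c₂ + height p)
  endRank-rank c₁ c₂ []      = sym (cong₂ (λ x y → rank m n (x , y)) (ℕP.+-identityʳ c₁) (ℕP.+-identityʳ c₂))
  endRank-rank c₁ c₂ (N ∷ p) = trans (cong (λ r → endRank r p) (rank-N c₁ c₂))
    (trans (endRank-rank c₁ (suc c₂) p) (cong (λ y → rank m n (c₁ + width p , y)) (sym (ℕP.+-suc c₂ (height p)))))
  endRank-rank c₁ c₂ (E ∷ p) = trans (cong (λ r → endRank r p) (rank-E c₁ c₂))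
    (trans (endRank-rank (suc c₁) c₂ p) (cong (λ x → rank m n (x , c₂ + height p)) (sym (ℕP.+-suc c₁ (width p)))))

  endRank-from-origin : ∀ p → endRank 0ℤ p ≡ rank m n (width p , height p)
  endRank-from-origin p = trans (cong (λ r → endRank r p) (sym rank-origin)) (endRank-rank 0 0 p)

  Corners : ℕ → ℕ → ℕ → ℕ → Set
  Corners a b e₁ e₂ = (a ≡ 0 × b ≡ 0) × (e₁ ≡ m × e₂ ≡ n)

  not-first : ∀ a b c₁ c₂ p → a ≤ c₁ → b ≤ c₂ → a + b < c₁ + c₂ → c₁ + width p ≤ m → c₂ + height p ≤ n →
    ¬ Corners a b (c₁ + width p) (c₂ + height p) → ¬ rank m n (a , b) ≡ rank m n (c₁ , c₂)
  not-first a b c₁ c₂ p a≤c₁ b≤c₂ a+b<c h₁ h₂ ¬corners same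
    with ordered-equal-rank a b c₁ c₂ a≤c₁ b≤c₂ a+b<c (ℕP.m+n≤o⇒m≤o c₁ h₁) (ℕP.m+n≤o⇒m≤o c₂ h₂) same
  ... | origin , (c₁≡m , c₂≡n) =
    ¬corners (origin , (ℕP.≤-antisym h₁ (subst (_≤ c₁ + width p) c₁≡m (ℕP.m≤m+n c₁ (width p))) ,
                        ℕP.≤-antisym h₂ (subst (_≤ c₂ + height p) c₂≡n (ℕP.m≤m+n c₂ (height p)))))

  not-among : ∀ p a b c₁ c₂ → a ≤ c₁ → b ≤ c₂ → a + b < c₁ + c₂ → c₁ + width p ≤ m → c₂ + height p ≤ n →
    ¬ Corners a b (c₁ + width p) (c₂ + height p) → All (λ x → ¬ rank m n (a , b) ≡ x) (ranks (rank m n (c₁ , c₂)) p)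
  not-among [] a b c₁ c₂ a≤c₁ b≤c₂ a+b<c h₁ h₂ ¬corners =
    not-first a b c₁ c₂ [] a≤c₁ b≤c₂ a+b<c h₁ h₂ ¬corners ∷ []
  not-among (N ∷ p) a b c₁ c₂ a≤c₁ b≤c₂ a+b<c h₁ h₂ ¬corners =
    not-first a b c₁ c₂ (N ∷ p) a≤c₁ b≤c₂ a+b<c h₁ h₂ ¬corners ∷
    subst (λ r → All (λ x → ¬ rank m n (a , b) ≡ x) (ranks r p)) (sym (rank-N c₁ c₂))
      (not-among p a b c₁ (suc c₂) a≤c₁ (ℕP.m≤n⇒m≤1+n b≤c₂)
         (ℕP.<-trans a+b<c (subst (c₁ + c₂ <_) (sym (ℕP.+-suc c₁ c₂)) (ℕP.n<1+n (c₁ + c₂))))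
         h₁ (subst (_≤ n) (ℕP.+-suc c₂ (height p)) h₂)
         (subst (λ e → ¬ Corners a b (c₁ + width p) e) (ℕP.+-suc c₂ (height p)) ¬corners))
  not-among (E ∷ p) a b c₁ c₂ a≤c₁ b≤c₂ a+b<c h₁ h₂ ¬corners =
    not-first a b c₁ c₂ (E ∷ p) a≤c₁ b≤c₂ a+b<c h₁ h₂ ¬corners ∷
    subst (λ r → All (λ x → ¬ rank m n (a , b) ≡ x) (ranks r p)) (sym (rank-E c₁ c₂))
      (not-among p a b (suc c₁) c₂ (ℕP.m≤n⇒m≤1+n a≤c₁) b≤c₂ (ℕP.<-trans a+b<c (ℕP.n<1+n (c₁ + c₂)))
         (subst (_≤ m) (ℕP.+-suc c₁ (width p)) h₁) h₂
         (subst (λ e → ¬ Corners a b e (c₂ + height p)) (ℕP.+-suc c₁ (width p)) ¬corners))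

  distinct-ranks : ∀ p c₁ c₂ → c₁ + width p ≤ m → c₂ + height p ≤ n →
    ¬ Corners c₁ c₂ (c₁ + width p) (c₂ + height p) → Distinct (rank m n (c₁ , c₂)) p
  distinct-ranks [] c₁ c₂ _ _ _ = [] ∷ []
  distinct-ranks (N ∷ p) c₁ c₂ h₁ h₂ ¬corners =
    subst (λ r → All (λ x → ¬ rank m n (c₁ , c₂) ≡ x) (ranks r p)) (sym (rank-N c₁ c₂))
      (not-among p c₁ c₂ c₁ (suc c₂) ℕP.≤-refl (ℕP.n≤1+n c₂) (subst (c₁ + c₂ <_) (sym (ℕP.+-suc c₁ c₂)) (ℕP.n<1+n (c₁ + c₂)))
         h₁ h₂′ (subst (λ e → ¬ Corners c₁ c₂ (c₁ + width p) e) (ℕP.+-suc c₂ (height p)) ¬corners)) ∷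
    subst (λ r → Distinct r p) (sym (rank-N c₁ c₂))
      (distinct-ranks p c₁ (suc c₂) h₁ h₂′ (λ { ((_ , ()) , _) }))
    where
    h₂′ : suc c₂ + height p ≤ n
    h₂′ = subst (_≤ n) (ℕP.+-suc c₂ (height p)) h₂
  distinct-ranks (E ∷ p) c₁ c₂ h₁ h₂ ¬corners =
    subst (λ r → All (λ x → ¬ rank m n (c₁ , c₂) ≡ x) (ranks r p)) (sym (rank-E c₁ c₂))
      (not-among p c₁ c₂ (suc c₁) c₂ (ℕP.n≤1+n c₁) ℕP.≤-refl (ℕP.n<1+n (c₁ + c₂))
         h₁′ h₂ (subst (λ e → ¬ Corners c₁ c₂ e (c₂ + height p)) (ℕP.+-suc c₁ (width p)) ¬corners)) ∷
    subst (λ r → Distinct r p) (sym (rank-E c₁ c₂))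
      (distinct-ranks p (suc c₁) c₂ h₁′ h₂ (λ { ((() , _) , _) }))
    where
    h₁′ : suc c₁ + width p ≤ m
    h₁′ = subst (_≤ m) (ℕP.+-suc c₁ (width p)) h₁

data ArgmaxFrom (i best : ℕ) (bv : ℤ) (xs : List ℤ) : ℕ → Set where
  keeps : All (ℤ._≤ bv) xs → ArgmaxFrom i best bv xs best
  moves : ∀ j → j < length xs → bv ℤ.≤ lookupℤ xs j → All (ℤ._≤ lookupℤ xs j) xs → ArgmaxFrom i best bv xs (i + j)

argmaxFrom-spec : ∀ i best bv xs → ArgmaxFrom i best bv xs (argmaxFrom i best bv xs)
argmaxFrom-spec i best bv []       = keeps []
argmaxFrom-spec i best bv (x ∷ xs) with x ℤ.≤? bv
... | yes x≤bv with argmaxFrom (suc i) best bv xs | argmaxFrom-spec (suc i) best bv xs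
...   | _ | keeps all≤bv = keeps (x≤bv ∷ all≤bv)
...   | _ | moves j j<l bv≤v all≤v =
  subst (ArgmaxFrom i best bv (x ∷ xs)) (ℕP.+-suc i j) (moves (suc j) (s≤s j<l) bv≤v (ℤP.≤-trans x≤bv bv≤v ∷ all≤v))
argmaxFrom-spec i best bv (x ∷ xs) | no x≰bv with argmaxFrom (suc i) i x xs | argmaxFrom-spec (suc i) i x xs
...   | _ | keeps all≤x =
  subst (ArgmaxFrom i best bv (x ∷ xs)) (ℕP.+-identityʳ i) (moves 0 (s≤s z≤n) bv≤x (ℤP.≤-refl ∷ all≤x))
  where bv≤x = ℤP.<⇒≤ (ℤP.≰⇒> x≰bv)
...   | _ | moves j j<l x≤v all≤v =
  subst (ArgmaxFrom i best bv (x ∷ xs)) (ℕP.+-suc i j)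
        (moves (suc j) (s≤s j<l) (ℤP.≤-trans (ℤP.<⇒≤ (ℤP.≰⇒> x≰bv)) x≤v) (x≤v ∷ all≤v))

argmax-spec : ∀ x xs → argmax (x ∷ xs) < suc (length xs) × All (ℤ._≤ lookupℤ (x ∷ xs) (argmax (x ∷ xs))) (x ∷ xs)
argmax-spec x xs with argmaxFrom 1 0 x xs | argmaxFrom-spec 1 0 x xs
... | _ | keeps all≤x           = s≤s z≤n , (ℤP.≤-refl ∷ all≤x)
... | _ | moves j j<l x≤v all≤v = s≤s j<l , (x≤v ∷ all≤v)

endpoint≡ : ∀ p → endpoint p ≡ (width p , height p)
endpoint≡ []      = refl
endpoint≡ (N ∷ p) rewrite endpoint≡ p = refl
endpoint≡ (E ∷ p) rewrite endpoint≡ p = refl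

module RankComplement (m n : ℕ) (m>0 : 0 < m) (n>0 : 0 < n) (coprime : Coprime m n) where
  open RankWalk m n
  open Ranks m n
  open Balance m n m>0 n>0
  open ReversedPieces m n
  open DinvAsPairs m n m>0 coprime
  open DistinctRanks m n m>0 coprime
  open ≡-Reasoning

  points-ranks : ∀ c p → map (rank m n) (scanl move c p) ≡ ranks (rank m n c) p
  points-ranks c []      = refl
  points-ranks c (s ∷ p) =
    cong (rank m n c ∷_) (trans (points-ranks (move c s) p) (cong (λ r → ranks r p) (sym (rank-move c s))))

  maxRankIndex-spec : ∀ D → let k = maxRankIndex m n D in All (ℤ._≤ endRank 0ℤ (take k D)) (ranks 0ℤ D)
  maxRankIndex-spec D =
    subst (λ k → All (ℤ._≤ endRank 0ℤ (take k D)) (ranks 0ℤ D)) (sym k≡)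
          (subst (All (ℤ._≤ endRank 0ℤ (take k D))) (sym (ranks-cons 0ℤ D)) all≤)
    where
    rankList : map (rank m n) (points D) ≡ 0ℤ ∷ laterRanks 0ℤ D
    rankList = trans (points-ranks (0 , 0) D) (trans (cong (λ r → ranks r D) rank-origin) (ranks-cons 0ℤ D))
    k≡ : maxRankIndex m n D ≡ argmax (0ℤ ∷ laterRanks 0ℤ D)
    k≡ = cong argmax rankList
    k : ℕ
    k = argmax (0ℤ ∷ laterRanks 0ℤ D)
    spec : k < suc (length (laterRanks 0ℤ D)) × All (ℤ._≤ lookupℤ (0ℤ ∷ laterRanks 0ℤ D) k) (0ℤ ∷ laterRanks 0ℤ D)
    spec = argmax-spec 0ℤ (laterRanks 0ℤ D)
    k≤length : k ≤ length D
    k≤length = subst (k ≤_) (length-laterRanks 0ℤ D) (ℕ.s≤s⁻¹ (proj₁ spec))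
    all≤ : All (ℤ._≤ endRank 0ℤ (take k D)) (0ℤ ∷ laterRanks 0ℤ D)
    all≤ = subst (λ v → All (ℤ._≤ v) (0ℤ ∷ laterRanks 0ℤ D))
                 (trans (cong (λ l → lookupℤ l k) (sym (ranks-cons 0ℤ D))) (lookup-ranks 0ℤ D k k≤length))
                 (proj₂ spec)

  dyck-shape : ∀ D → IsDyck m n D → width D ≡ m × height D ≡ n
  dyck-shape D (ends , _) = cong proj₁ corner , cong proj₂ corner
    where corner = trans (sym (endpoint≡ D)) ends

  dyck-nonneg : ∀ D → IsDyck m n D → All (0ℤ ℤ.≤_) (ranks 0ℤ D)
  dyck-nonneg D (_ , above) =
    subst (All (0ℤ ℤ.≤_)) (trans (points-ranks (0 , 0) D) (cong (λ r → ranks r D) rank-origin))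
          (AllP.map⁺ (All.map (λ { {a , b} na≤mb → ℤP.i≤j⇒0≤j-i (ℤ.+≤+ na≤mb) }) above))

  -- A nonnegative walk from 0 with an E step must begin with an N step, so its
  -- maximal rank is positive.
  max-positive : ∀ D M → width D ≡ m → All (0ℤ ℤ.≤_) (ranks 0ℤ D) → All (ℤ._≤ M) (ranks 0ℤ D) → 0ℤ ℤ.< M
  max-positive []      M w≡m _               _             = ⊥-elim (ℕP.<-irrefl w≡m m>0)
  max-positive (N ∷ D) M _   _               (_ ∷ ≤M)      = ℤP.<-≤-trans (ℤ.+<+ m>0) (ranks-head (0ℤ +ℤ + m) D ≤M)
  max-positive (E ∷ D) M _   (_ ∷ nonneg)    _             =
    ⊥-elim (ℤP.<-irrefl refl (ℤP.≤-<-trans (ranks-head (0ℤ -ℤ + n) D nonneg) (i-n<i 0ℤ)))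

  -- Cutting a Dyck path D = Q₁ Q₂ at a point of maximal rank M: the rising piece Q₁
  -- (ranks from its minimum 0 up to its maximum M) and the falling piece Q₂ (from M
  -- down to 0) have distinct ranks by coprimality, hence are balanced.
  pieces-balanced : ∀ Q₁ Q₂ → width (Q₁ ++ Q₂) ≡ m → height (Q₁ ++ Q₂) ≡ n →
    All (λ x → 0ℤ ℤ.≤ x × x ℤ.≤ endRank 0ℤ Q₁) (ranks 0ℤ (Q₁ ++ Q₂)) →
    endRank 0ℤ (Q₁ ++ Q₂) ≡ 0ℤ → 0ℤ ℤ.< endRank 0ℤ Q₁ →
    Balanced 0ℤ Q₁ × Balanced (endRank 0ℤ Q₁) Q₂
  pieces-balanced Q₁ Q₂ w≡m h≡n bounds closed M>0 =
    balanced-ascending Q₁ 0ℤ distinct₁ (proj₁ pieces) ,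
    balanced-descending Q₂ M distinct₂
      (subst (λ e → All (λ x → e ℤ.≤ x × x ℤ.≤ M) (ranks M Q₂)) (sym fallsTo0) (proj₂ pieces))
    where
    M : ℤ
    M = endRank 0ℤ Q₁
    pieces : All (λ x → 0ℤ ℤ.≤ x × x ℤ.≤ M) (ranks 0ℤ Q₁) × All (λ x → 0ℤ ℤ.≤ x × x ℤ.≤ M) (ranks M Q₂)
    pieces = ranks-split 0ℤ Q₁ Q₂ bounds
    fallsTo0 : endRank M Q₂ ≡ 0ℤ
    fallsTo0 = trans (sym (endRank-++ 0ℤ Q₁ Q₂)) closed
    w₁+w₂ : width Q₁ + width Q₂ ≡ m
    w₁+w₂ = trans (sym (count-++ isE Q₁ Q₂)) w≡m
    h₁+h₂ : height Q₁ + height Q₂ ≡ n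
    h₁+h₂ = trans (sym (count-++ isN Q₁ Q₂)) h≡n
    -- M > 0 is not the rank 0 of either corner
    M≢corner : ∀ {a b} → a ≡ width Q₁ → b ≡ height Q₁ → rank m n (a , b) ≡ 0ℤ → ⊥
    M≢corner refl refl rank≡0 = ℤP.<-irrefl (sym (trans (endRank-from-origin Q₁) rank≡0)) M>0
    distinct₁ : Distinct 0ℤ Q₁
    distinct₁ = subst (λ r → Distinct r Q₁) rank-origin
      (distinct-ranks Q₁ 0 0 (subst (width Q₁ ≤_) w₁+w₂ (ℕP.m≤m+n (width Q₁) (width Q₂)))
                             (subst (height Q₁ ≤_) h₁+h₂ (ℕP.m≤m+n (height Q₁) (height Q₂)))
                             (λ { (_ , (w≡m , h≡n)) → M≢corner (sym w≡m) (sym h≡n) rank-corner }))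
    distinct₂ : Distinct M Q₂
    distinct₂ = subst (λ r → Distinct r Q₂) (sym (endRank-from-origin Q₁))
      (distinct-ranks Q₂ (width Q₁) (height Q₁) (ℕP.≤-reflexive w₁+w₂) (ℕP.≤-reflexive h₁+h₂)
                      (λ { ((w≡0 , h≡0) , _) → M≢corner (sym w≡0) (sym h≡0) rank-origin }))

  complement-invariant : ∀ D k → IsDyck m n D → All (ℤ._≤ endRank 0ℤ (take k D)) (ranks 0ℤ D) →
    dinv m n (reverse (take k D) ++ reverse (drop k D)) ≡ dinv m n D
  complement-invariant D k dyck ≤M = begin
    dinv m n (reverse Q₁ ++ reverse Q₂)                 ≡⟨ dinv≡pairs (reverse Q₁ ++ reverse Q₂) w′≡m h′≡n ⟩
    pairs dinvPair (walk 0ℤ (reverse Q₁ ++ reverse Q₂)) ≡⟨ pairs-reverse-pieces Q₁ Q₂ closed rising falling ⟩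
    pairs dinvPair (walk 0ℤ (Q₁ ++ Q₂))                 ≡⟨ cong (λ p → pairs dinvPair (walk 0ℤ p)) split ⟩
    pairs dinvPair (walk 0ℤ D)                          ≡⟨ dinv≡pairs D w≡m h≡n ⟨
    dinv m n D                                          ∎
    where
    Q₁ Q₂ : Path
    Q₁ = take k D
    Q₂ = drop k D
    split : Q₁ ++ Q₂ ≡ D
    split = take++drop≡id k D
    w≡m : width D ≡ m
    w≡m = proj₁ (dyck-shape D dyck)
    h≡n : height D ≡ n
    h≡n = proj₂ (dyck-shape D dyck)
    w′≡m : width (reverse Q₁ ++ reverse Q₂) ≡ m
    w′≡m = trans (count-reverse-pieces isE Q₁ Q₂) (trans (cong width split) w≡m)
    h′≡n : height (reverse Q₁ ++ reverse Q₂) ≡ n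
    h′≡n = trans (count-reverse-pieces isN Q₁ Q₂) (trans (cong height split) h≡n)
    closed : endRank 0ℤ (Q₁ ++ Q₂) ≡ 0ℤ
    closed = trans (cong (endRank 0ℤ) split)
                   (trans (endRank-from-origin D) (trans (cong₂ (λ a b → rank m n (a , b)) w≡m h≡n) rank-corner))
    bounds : All (λ x → 0ℤ ℤ.≤ x × x ℤ.≤ endRank 0ℤ Q₁) (ranks 0ℤ (Q₁ ++ Q₂))
    bounds = subst (λ p → All (λ x → 0ℤ ℤ.≤ x × x ℤ.≤ endRank 0ℤ Q₁) (ranks 0ℤ p)) (sym split)
                   (All.zip (dyck-nonneg D dyck , ≤M))
    balanced : Balanced 0ℤ Q₁ × Balanced (endRank 0ℤ Q₁) Q₂
    balanced = pieces-balanced Q₁ Q₂ (trans (cong width split) w≡m) (trans (cong height split) h≡n) bounds closed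
                 (max-positive D (endRank 0ℤ Q₁) w≡m (dyck-nonneg D dyck) ≤M)
    rising : Balanced 0ℤ Q₁
    rising = proj₁ balanced
    falling : Balanced (endRank 0ℤ Q₁) Q₂
    falling = proj₂ balanced

corollary5p4 : (m n : ℕ) → 0 < m → 0 < n → Coprime m n →
    (D : Path) → IsDyck m n D → dinv m n (rankComplement m n D) ≡ dinv m n D
corollary5p4 m n m>0 n>0 coprime D dyck =
  complement-invariant D (maxRankIndex m n D) dyck (maxRankIndex-spec D)
  where open RankComplement m n m>0 n>0 coprime
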